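{- Let $d\ge1$ be an integer. Let $\mathfrak{G}_d$ be the set of non-empty partitions $\pi=(\pi_1,\ldots,\pi_r)$ such that (i) $\pi_i\equiv 1$ or $d+2\pmod{2d+1}$ for all $i=1,\ldots,r$; and (ii) $\pi_i-\pi_{i+1}\le 2d+1$ for all $i=1,\ldots,r$, where $\pi_{r+1}:=0$, with strict inequality $\pi_i-\pi_{i+1}<2d+1$ whenever $\pi_i\equiv1\pmod{2d+1}$. Then, as formal power series, $$\sum_{\pi\in\mathfrak{G}_d}x^{\pi_1}y^{\ell(\pi)}q^{\Gamma(\pi)}=\frac{xyq(1-yq+x^{d+1}q^{d+1})}{1-2yq+y^2q^2-x^{2d+1}yq^{2d+2}}.$$ Moreover, for all $n\ge1$, $h_d(n)=f_d(n)=g_d(n)$, where $h_d(n)$ is the number of partitions $\pi$ with $\Gamma(\pi)=n$ whose parts pairwise differ by at least $d$, $f_d(n)$ is the number of partitions $\pi$ with $\Gamma(\pi)=n$ all of whose parts are $\equiv1\pmod{d+1}$, and $g_d(n)$ is the number of $\pi\in\mathfrak{G}_d$ with $\Gamma(\pi)=n$.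
   Context: For a non-empty partition $\pi=(\pi_1\ge\cdots\ge\pi_r\ge1)$, $\ell(\pi)=r$ and $\Gamma(\pi)=\pi_1+\ell(\pi)-1$ (length of the largest hook). -}

module Defs where

open import Data.Nat using (ℕ; zero; suc; _+_; _*_; _∸_; _≤_; _<_; _≥_; _≟_; _≤?_; _<?_)
open import Data.Nat.DivMod using (_%_)
open import Data.Integer as ℤ using (ℤ; +_; -_)
open import Data.List using (List; []; _∷_; length; map; concatMap; filter; upTo; _∷ʳ_)
open import Data.List.Relation.Unary.All using (All; all?)
open import Data.List.Relation.Unary.Linked using (Linked; linked?)
open import Data.List.Relation.Unary.AllPairs using (AllPairs; allPairs?)
open import Data.Product using (_×_)
open import Data.Sum using (_⊎_)
open import Relation.Nullary using (Dec; yes; no)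
open import Relation.Nullary.Decidable using (_×-dec_; _→-dec_; _⊎-dec_)
open import Relation.Unary using (Pred; Decidable)
open import Relation.Binary.PropositionalEquality using (_≡_)
open import Level using (0ℓ)

IsPartition : List ℕ → Set
IsPartition π = Linked _≥_ π × All (1 ≤_) π

NonEmpty : List ℕ → Set
NonEmpty π = 1 ≤ length π

-- largest part π₁ (only used on non-empty lists)
π₁ : List ℕ → ℕ
π₁ []      = 0
π₁ (p ∷ _) = p

ℓ : List ℕ → ℕ
ℓ = length

-- largest hook Γ(π) = π₁ + ℓ(π) − 1 (for non-empty π)
Γ : List ℕ → ℕ
Γ π = π₁ π + ℓ π ∸ 1

-- Every non-empty partition with Γ(π) = n has all parts ≤ n
-- and at most n parts, so it occurs (exactly once) in  candidates n,
-- the list of all lists of length ≤ n with entries in {1,…,n}.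

listsUpTo : ℕ → ℕ → List (List ℕ)
listsUpTo m zero    = [] ∷ []
listsUpTo m (suc l) = [] ∷ concatMap (λ x → map (x ∷_) (listsUpTo m l)) (map suc (upTo m))

candidates : ℕ → List (List ℕ)
candidates n = listsUpTo n n

PartΓ : ℕ → (List ℕ → Set) → List ℕ → Set
PartΓ n P π = (IsPartition π × NonEmpty π) × (Γ π ≡ n × P π)

partΓ? : (n : ℕ) (P : List ℕ → Set) → Decidable P → Decidable (PartΓ n P)
partΓ? n P P? π =
  ((linked? (λ a b → b ≤? a) π ×-dec all? (1 ≤?_) π) ×-dec (1 ≤? length π))
  ×-dec ((Γ π ≟ n) ×-dec P? π)

#[_] : ℕ → (P : List ℕ → Set) → Decidable P → ℕ
#[ n ] P P? = length (filter (partΓ? n P P?) (candidates n))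

M : ℕ → ℕ
M d = suc (2 * d)

ResidueOK : ℕ → ℕ → Set
ResidueOK d p = p % M d ≡ 1 % M d ⊎ p % M d ≡ (d + 2) % M d

GapOK : ℕ → ℕ → ℕ → Set
GapOK d a b = (a ∸ b ≤ M d) × (a % M d ≡ 1 % M d → a ∸ b < M d)

-- π ∈ 𝔊_d  (non-emptiness and being a partition are imposed in PartΓ)
InG : ℕ → List ℕ → Set
InG d π = All (ResidueOK d) π × Linked (GapOK d) (π ∷ʳ 0)

InG? : (d : ℕ) → Decidable (InG d)
InG? d π =
  all? (λ p → (p % M d ≟ 1 % M d) ⊎-dec (p % M d ≟ (d + 2) % M d)) π
  ×-dec linked? (λ a b → (a ∸ b ≤? M d) ×-dec ((a % M d ≟ 1 % M d) →-dec (a ∸ b <? M d))) (π ∷ʳ 0)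

-- parts pairwise differ by at least d (π is weakly decreasing, so a ∸ b = |a − b|)
DiffAtLeast : ℕ → List ℕ → Set
DiffAtLeast d π = AllPairs (λ a b → d ≤ a ∸ b) π

DiffAtLeast? : (d : ℕ) → Decidable (DiffAtLeast d)
DiffAtLeast? d = allPairs? (λ a b → d ≤? a ∸ b)

AllOneMod : ℕ → List ℕ → Set
AllOneMod d π = All (λ p → p % suc d ≡ 1 % suc d) π

AllOneMod? : (d : ℕ) → Decidable (AllOneMod d)
AllOneMod? d = all? (λ p → p % suc d ≟ 1 % suc d)

h f g : ℕ → ℕ → ℕ
h d n = #[ n ] (DiffAtLeast d) (DiffAtLeast? d)
f d n = #[ n ] (AllOneMod d) (AllOneMod? d)
g d n = #[ n ] (InG d) (InG? d)

-- Formal power series in x, y, q with integer coefficients: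
-- S i j k = coefficient of x^i y^j q^k.

FPS : Set
FPS = ℕ → ℕ → ℕ → ℤ

sumTo : ℕ → (ℕ → ℤ) → ℤ
sumTo zero    u = u 0
sumTo (suc n) u = sumTo n u ℤ.+ u (suc n)

_⊛_ : FPS → FPS → FPS
(S ⊛ T) i j k =
  sumTo i λ a → sumTo j λ b → sumTo k λ c → S a b c ℤ.* T (i ∸ a) (j ∸ b) (k ∸ c)

_⊕_ : FPS → FPS → FPS
(S ⊕ T) i j k = S i j k ℤ.+ T i j k

infixl 6 _⊕_
infixl 7 _⊛_
infix 4 _≐_

_≐_ : FPS → FPS → Set
S ≐ T = ∀ i j k → S i j k ≡ T i j k

mono : ℤ → ℕ → ℕ → ℕ → FPS
mono s a b c i j k with i ≟ a | j ≟ b | k ≟ c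
... | yes _ | yes _ | yes _ = s
... | _     | _     | _     = + 0

GenG : ℕ → FPS
GenG d i j k = + #[ k ] (λ π → InG d π × (π₁ π ≡ i × ℓ π ≡ j))
                        (λ π → InG? d π ×-dec ((π₁ π ≟ i) ×-dec (ℓ π ≟ j)))

-- numerator  xyq(1 − yq + x^{d+1} q^{d+1})
Num : ℕ → FPS
Num d = mono (+ 1) 1 1 1 ⊕ mono (- + 1) 1 2 2 ⊕ mono (+ 1) (d + 2) 1 (d + 2)

-- denominator  1 − 2yq + y²q² − x^{2d+1} y q^{2d+2}
Den : ℕ → FPS
Den d = mono (+ 1) 0 0 0 ⊕ mono (- + 2) 0 1 1 ⊕ mono (+ 1) 0 2 2
        ⊕ mono (- + 1) (M d) 1 (suc (M d))

module Submission where

-- Read a partition from its largest part downwards: each of the three families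
-- (parts differing by at least d; parts ≡ 1 mod d+1; 𝔊_d) consists of the chains
-- a₁ ≥ a₂ ≥ ⋯ obeying a condition on each part, on consecutive parts and on the
-- last part.  Let chains a t count those with largest part a and t further parts;
-- the partitions with Γ = n are counted by Σ_{a ≤ n} chains a (n − a).  In each
-- family a local recursion for chains a t shows that this count X satisfies
-- X 0 = 0, X 1 = 1 and X (n+2) = X (n+1) + X (n+1−d), so the three counts agree.
-- For 𝔊_d the recursions also give, with m = 2d+1,
--   chains i (t+2) − 2 chains i (t+1) + chains i t = chains (i − m) (t+1),
-- and at t = −1 the same with the correction [i = 1].  The generating function is
-- supported on the diagonal i + j = k + 1 of x^i y^j q^k, multiplication by a
-- monomial x^a y^b q^(a+b) preserves that diagonal, and the numerator lives on it
-- too; comparing the profiles along the diagonal is exactly this recursion.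

open import Defs
open import Data.Nat using (ℕ; zero; suc; _+_; _*_; _∸_; _≤_; _<_; _≟_; _≤?_; _<?_; z≤n; s≤s; s≤s⁻¹)
open import Data.Nat.Properties
open import Data.Nat.DivMod
open import Data.List using (List; []; _∷_; length; map; concatMap; filter; applyUpTo; _++_)
open import Data.List.Properties using (length-++; filter-++; filter-≐; filter-none; map-applyUpTo)
open import Data.List.Relation.Unary.All as All using (All; []; _∷_)
open import Data.List.Relation.Unary.Linked using ([-]; _∷_)
open import Data.List.Relation.Unary.AllPairs using ([]; _∷_)
open import Data.Product using (_×_; _,_; proj₁; proj₂)
open import Data.Sum using (_⊎_; inj₁; inj₂; [_,_]′)
open import Data.Unit using (⊤; tt)
open import Data.Empty using (⊥-elim)
open import Function using (_∘_; id)
open import Relation.Nullary using (Dec; yes; no; ¬_)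
open import Relation.Nullary.Decidable using (_×-dec_; _⊎-dec_; _→-dec_)
open import Relation.Unary using (Pred; Decidable; _⊆_)
open import Relation.Binary.PropositionalEquality
open import Algebra.Properties.CommutativeSemigroup +-commutativeSemigroup using (interchange)
open import Level using (0ℓ)
open import Data.Nat.Tactic.RingSolver using (solve-∀)
open import Data.Integer as ℤ using (ℤ; -_)
import Data.Integer.Properties as ℤ
open import Data.Integer.Tactic.RingSolver using () renaming (solve-∀ to solveℤ-∀)

private variable
  A B C : Set
  v w : ℕ

when : Dec A → ℕ → ℕ
when (yes _) v = v
when (no _)  _ = 0

when-yes : (a? : Dec A) → A → ∀ v → when a? v ≡ v
when-yes (yes _) _ _ = refl
when-yes (no ¬a) a _ = ⊥-elim (¬a a)

when-no : (a? : Dec A) → ¬ A → ∀ v → when a? v ≡ 0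
when-no (yes a) ¬a _ = ⊥-elim (¬a a)
when-no (no _)  _  _ = refl

when-zero : (a? : Dec A) → when a? 0 ≡ 0
when-zero (yes _) = refl
when-zero (no _)  = refl

when-cong : (a? : Dec A) (b? : Dec B) → (A → B) → (B → A) → (A → v ≡ w) → when a? v ≡ when b? w
when-cong (yes a) (yes _) _ _ v≡w = v≡w a
when-cong (yes a) (no ¬b) f _ _   = ⊥-elim (¬b (f a))
when-cong (no ¬a) (yes b) _ g _   = ⊥-elim (¬a (g b))
when-cong (no _)  (no _)  _ _ _   = refl

when-⇔ : (a? : Dec A) (b? : Dec B) → (A → B) → (B → A) → ∀ v → when a? v ≡ when b? v
when-⇔ a? b? f g v = when-cong a? b? f g (λ _ → refl)

when-⊎ : (a? : Dec A) (b? : Dec B) (c? : Dec C) → (A → B ⊎ C) → (B → A) → (C → A) → (B → ¬ C) →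
  ∀ v → when a? v ≡ when b? v + when c? v
when-⊎ a?      (yes b) (yes c) _   _   _   excl _ = ⊥-elim (excl b c)
when-⊎ a?      (yes b) (no _)  _   b⇒a _   _    v = trans (when-yes a? (b⇒a b) v) (sym (+-identityʳ v))
when-⊎ a?      (no _)  (yes c) _   _   c⇒a _    v = when-yes a? (c⇒a c) v
when-⊎ (yes a) (no ¬b) (no ¬c) a⇒  _   _   _    _ = ⊥-elim ([ ¬b , ¬c ]′ (a⇒ a))
when-⊎ (no _)  (no _)  (no _)  _   _   _   _    _ = refl

when-+ : (a? : Dec A) → ∀ v w → when a? (v + w) ≡ when a? v + when a? w
when-+ (yes _) _ _ = refl
when-+ (no _)  _ _ = refl

when-× : (a? : Dec A) (b? : Dec B) → ∀ v → when (a? ×-dec b?) v ≡ when a? (when b? v)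
when-× (yes _) (yes _) _ = refl
when-× (yes _) (no _)  _ = refl
when-× (no _)  _       _ = refl

when-comm : (a? : Dec A) (b? : Dec B) → ∀ v → when a? (when b? v) ≡ when b? (when a? v)
when-comm (yes _) (yes _) _ = refl
when-comm (yes _) (no _)  _ = refl
when-comm (no _)  (yes _) _ = refl
when-comm (no _)  (no _)  _ = refl

m>n⇒m∸n≡1+[m∸1+n] : ∀ {m n} → n < m → m ∸ n ≡ suc (m ∸ suc n)
m>n⇒m∸n≡1+[m∸1+n] {suc m} {zero}  _         = refl
m>n⇒m∸n≡1+[m∸1+n] {suc m} {suc n} (s≤s n<m) = m>n⇒m∸n≡1+[m∸1+n] n<m

Σ< : ℕ → (ℕ → ℕ) → ℕ
Σ< zero    G = 0
Σ< (suc m) G = G 0 + Σ< m (G ∘ suc)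

Σ<-cong : ∀ m {F G : ℕ → ℕ} → (∀ i → i < m → F i ≡ G i) → Σ< m F ≡ Σ< m G
Σ<-cong zero    _   = refl
Σ<-cong (suc m) F≡G = cong₂ _+_ (F≡G 0 (s≤s z≤n)) (Σ<-cong m (λ i i<m → F≡G (suc i) (s≤s i<m)))

Σ<-zero : ∀ m {G : ℕ → ℕ} → (∀ i → i < m → G i ≡ 0) → Σ< m G ≡ 0
Σ<-zero zero    _   = refl
Σ<-zero (suc m) G≡0 = cong₂ _+_ (G≡0 0 (s≤s z≤n)) (Σ<-zero m (λ i i<m → G≡0 (suc i) (s≤s i<m)))

Σ<-+ : ∀ m (F G : ℕ → ℕ) → Σ< m (λ i → F i + G i) ≡ Σ< m F + Σ< m G
Σ<-+ zero    F G = refl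
Σ<-+ (suc m) F G =
  trans (cong (F 0 + G 0 +_) (Σ<-+ m (F ∘ suc) (G ∘ suc))) (interchange (F 0) (G 0) _ _)

Σ<-when : ∀ m (a? : Dec A) (G : ℕ → ℕ) → Σ< m (λ i → when a? (G i)) ≡ when a? (Σ< m G)
Σ<-when m (yes _) G = refl
Σ<-when m (no _)  G = Σ<-zero m (λ _ _ → refl)

Σ<-snoc : ∀ m (G : ℕ → ℕ) → Σ< (suc m) G ≡ Σ< m G + G m
Σ<-snoc zero    G = +-comm (G 0) 0
Σ<-snoc (suc m) G = trans (cong (G 0 +_) (Σ<-snoc m (G ∘ suc))) (sym (+-assoc (G 0) _ _))

Σ<-split : ∀ m n (G : ℕ → ℕ) → Σ< (m + n) G ≡ Σ< m G + Σ< n (λ i → G (m + i))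
Σ<-split zero    n G = refl
Σ<-split (suc m) n G = trans (cong (G 0 +_) (Σ<-split m n (G ∘ suc))) (sym (+-assoc (G 0) _ _))

Σ<-prefix : ∀ c m (G : ℕ → ℕ) → c ≤ m → (∀ i → c ≤ i → i < m → G i ≡ 0) → Σ< m G ≡ Σ< c G
Σ<-prefix c m G c≤m tail≡0 = begin
  Σ< m G                                        ≡⟨ cong (λ n → Σ< n G) (sym (m+[n∸m]≡n c≤m)) ⟩
  Σ< (c + (m ∸ c)) G                            ≡⟨ Σ<-split c (m ∸ c) G ⟩
  Σ< c G + Σ< (m ∸ c) (λ i → G (c + i))        ≡⟨ cong (Σ< c G +_) (Σ<-zero (m ∸ c) tail) ⟩
  Σ< c G + 0                                    ≡⟨ +-identityʳ _ ⟩
  Σ< c G                                        ∎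
  where
  open ≡-Reasoning
  tail : ∀ i → i < m ∸ c → G (c + i) ≡ 0
  tail i i<m∸c = tail≡0 (c + i) (m≤m+n c i) (subst (c + i <_) (m+[n∸m]≡n c≤m) (+-monoʳ-< c i<m∸c))

Σ<-point : ∀ m c v → Σ< m (λ i → when (i ≟ c) v) ≡ when (c <? m) v
Σ<-point zero    c       v = sym (when-no (c <? 0) (λ ()) v)
Σ<-point (suc m) zero    v = begin
  v + Σ< m (λ i → when (suc i ≟ 0) v) ≡⟨ cong (v +_) (Σ<-zero m (λ _ _ → refl)) ⟩
  v + 0                               ≡⟨ +-identityʳ v ⟩
  v                                   ≡⟨ sym (when-yes (0 <? suc m) (s≤s z≤n) v) ⟩
  when (0 <? suc m) v                 ∎
  where open ≡-Reasoning
Σ<-point (suc m) (suc c) v = begin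
  Σ< m (λ i → when (suc i ≟ suc c) v)  ≡⟨ Σ<-cong m (λ i _ → when-⇔ (suc i ≟ suc c) (i ≟ c) suc-injective (cong suc) v) ⟩
  Σ< m (λ i → when (i ≟ c) v)          ≡⟨ Σ<-point m c v ⟩
  when (c <? m) v                      ≡⟨ when-⇔ (c <? m) (suc c <? suc m) s≤s s≤s⁻¹ v ⟩
  when (suc c <? suc m) v              ∎
  where open ≡-Reasoning

Σ<-drop : ∀ m c (G : ℕ → ℕ) → (∀ i → i < c → G i ≡ 0) → Σ< m G ≡ Σ< (m ∸ c) (λ i → G (c + i))
Σ<-drop m c G head≡0 with c ≤? m
... | yes c≤m = begin
  Σ< m G                                        ≡⟨ cong (λ n → Σ< n G) (sym (m+[n∸m]≡n c≤m)) ⟩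
  Σ< (c + (m ∸ c)) G                            ≡⟨ Σ<-split c (m ∸ c) G ⟩
  Σ< c G + Σ< (m ∸ c) (λ i → G (c + i))        ≡⟨ cong (_+ Σ< (m ∸ c) (λ i → G (c + i))) (Σ<-zero c head≡0) ⟩
  Σ< (m ∸ c) (λ i → G (c + i))                  ∎
  where open ≡-Reasoning
... | no c≰m = begin
  Σ< m G                                        ≡⟨ Σ<-zero m (λ i i<m → head≡0 i (<-≤-trans i<m m≤c)) ⟩
  0                                             ≡⟨ cong (λ n → Σ< n (λ i → G (c + i))) (sym (m≤n⇒m∸n≡0 m≤c)) ⟩
  Σ< (m ∸ c) (λ i → G (c + i))                  ∎
  where
  open ≡-Reasoning
  m≤c = <⇒≤ (≰⇒> c≰m)

Σ<-restrict : ∀ m c {P : ℕ → Set} (P? : ∀ i → Dec (P i)) (G : ℕ → ℕ) → c ≤ m →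
  (∀ i → i < m → P i → i < c) → (∀ i → i < c → P i) →
  Σ< m (λ i → when (P? i) (G i)) ≡ Σ< c G
Σ<-restrict m c P? G c≤m P⇒<c <c⇒P = trans
  (Σ<-prefix c m _ c≤m (λ i c≤i i<m → when-no (P? i) (λ p → <⇒≱ (P⇒<c i i<m p) c≤i) _))
  (Σ<-cong c (λ i i<c → when-yes (P? i) (<c⇒P i i<c) _))

Σ<-point-shift : ∀ a δ (F : ℕ → ℕ) → F 0 ≡ 0 → Σ< a (λ i → when (suc i + δ ≟ a) (F (suc i))) ≡ F (a ∸ δ)
Σ<-point-shift a δ F F0≡0 with δ <? a
... | yes δ<a = begin
  Σ< a (λ i → when (suc i + δ ≟ a) (F (suc i)))    ≡⟨ Σ<-cong a (λ i _ → when-cong (suc i + δ ≟ a) (i ≟ a ∸ suc δ) to from value) ⟩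
  Σ< a (λ i → when (i ≟ a ∸ suc δ) (F (a ∸ δ)))    ≡⟨ Σ<-point a (a ∸ suc δ) (F (a ∸ δ)) ⟩
  when (a ∸ suc δ <? a) (F (a ∸ δ))                 ≡⟨ when-yes (a ∸ suc δ <? a) (∸-monoʳ-< (s≤s z≤n) δ<a) _ ⟩
  F (a ∸ δ)                                         ∎
  where
  open ≡-Reasoning
  a∸δ≡ : ∀ {i} → suc i + δ ≡ a → a ∸ δ ≡ suc i
  a∸δ≡ {i} e = trans (cong (_∸ δ) (sym e)) (m+n∸n≡m (suc i) δ)
  to : ∀ {i} → suc i + δ ≡ a → i ≡ a ∸ suc δ
  to {i} e = sym (trans (cong (a ∸_) (+-comm 1 δ)) (trans (sym (∸-+-assoc a δ 1)) (cong (_∸ 1) (a∸δ≡ e))))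
  from : ∀ {i} → i ≡ a ∸ suc δ → suc i + δ ≡ a
  from refl = trans (+-comm (suc (a ∸ suc δ)) δ) (trans (+-suc δ (a ∸ suc δ)) (m+[n∸m]≡n δ<a))
  value : ∀ {i} → suc i + δ ≡ a → F (suc i) ≡ F (a ∸ δ)
  value e = cong F (sym (a∸δ≡ e))
... | no δ≮a = begin
  Σ< a (λ i → when (suc i + δ ≟ a) (F (suc i)))    ≡⟨ Σ<-zero a (λ i _ → when-no (suc i + δ ≟ a) (λ e → δ≮a (subst (δ <_) e (s≤s (m≤n+m δ i)))) _) ⟩
  0                                                 ≡⟨ sym F0≡0 ⟩
  F 0                                               ≡⟨ cong F (sym (m≤n⇒m∸n≡0 (≮⇒≥ δ≮a))) ⟩
  F (a ∸ δ)                                         ∎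
  where open ≡-Reasoning

count : {P : Pred A 0ℓ} → Decidable P → List A → ℕ
count P? xs = length (filter P? xs)

module _ {P Q : Pred A 0ℓ} (P? : Decidable P) (Q? : Decidable Q) where

  count-cong : P ⊆ Q → Q ⊆ P → ∀ xs → count P? xs ≡ count Q? xs
  count-cong P⊆Q Q⊆P xs = cong length (filter-≐ P? Q? (P⊆Q , Q⊆P) xs)

module _ {P : Pred A 0ℓ} (P? : Decidable P) where

  count-++ : ∀ xs ys → count P? (xs ++ ys) ≡ count P? xs + count P? ys
  count-++ xs ys = trans (cong length (filter-++ P? xs ys)) (length-++ (filter P? xs))

  count-singleton : ∀ x → count P? (x ∷ []) ≡ when (P? x) 1
  count-singleton x with P? x
  ... | yes _ = refl
  ... | no _  = refl

  count-none : (∀ x → ¬ P x) → ∀ xs → count P? xs ≡ 0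
  count-none ¬P xs = cong length (filter-none P? (All.universal ¬P xs))

  count-map : (f : B → A) → ∀ xs → count P? (map f xs) ≡ count (P? ∘ f) xs
  count-map f []       = refl
  count-map f (x ∷ xs) with P? (f x)
  ... | yes _ = cong suc (count-map f xs)
  ... | no _  = count-map f xs

  count-concatMap : (K : ℕ → List A) (g : ℕ → ℕ) →
    ∀ m → count P? (concatMap K (applyUpTo g m)) ≡ Σ< m (λ i → count P? (K (g i)))
  count-concatMap K g zero    = refl
  count-concatMap K g (suc m) =
    trans (count-++ (K (g 0)) _) (cong (count P? (K (g 0)) +_) (count-concatMap K (g ∘ suc) m))

count-const : {C : Set} {P : Pred A 0ℓ} (C? : Dec C) (P? : Decidable P) →
  ∀ xs → count (λ x → C? ×-dec P? x) xs ≡ when C? (count P? xs)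
count-const (yes c) P? = count-cong _ P? proj₂ (c ,_)
count-const (no ¬c) P? = count-none _ (λ _ → ¬c ∘ proj₁)

count-listsUpTo : ∀ m l {P : Pred (List ℕ) 0ℓ} (P? : Decidable P) →
  count P? (listsUpTo m (suc l)) ≡ when (P? []) 1 + Σ< m (λ i → count (λ xs → P? (suc i ∷ xs)) (listsUpTo m l))
count-listsUpTo m l P? = begin
  count P? (listsUpTo m (suc l))
    ≡⟨ count-++ P? ([] ∷ []) _ ⟩
  count P? ([] ∷ []) + count P? (concatMap (λ x → map (x ∷_) (listsUpTo m l)) (map suc (applyUpTo id m)))
    ≡⟨ cong₂ _+_ (count-singleton P? []) (cong (count P? ∘ concatMap _) (map-applyUpTo id suc m)) ⟩
  when (P? []) 1 + count P? (concatMap (λ x → map (x ∷_) (listsUpTo m l)) (applyUpTo suc m))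
    ≡⟨ cong (when (P? []) 1 +_) (count-concatMap P? (λ x → map (x ∷_) (listsUpTo m l)) suc m) ⟩
  when (P? []) 1 + Σ< m (λ i → count P? (map (suc i ∷_) (listsUpTo m l)))
    ≡⟨ cong (when (P? []) 1 +_) (Σ<-cong m (λ i _ → count-map P? (suc i ∷_) (listsUpTo m l))) ⟩
  when (P? []) 1 + Σ< m (λ i → count (λ xs → P? (suc i ∷ xs)) (listsUpTo m l)) ∎
  where open ≡-Reasoning

module Chains (U : Pred ℕ 0ℓ) (U? : Decidable U) (R : ℕ → ℕ → Set) (R? : ∀ a b → Dec (R a b))
              (E : Pred ℕ 0ℓ) (E? : Decidable E)
              (U⇒pos : ∀ {a} → U a → 1 ≤ a) (R⇒≥ : ∀ {a b} → R a b → b ≤ a) where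

  Chain : ℕ → List ℕ → Set
  Chain a []       = U a × E a
  Chain a (b ∷ xs) = U a × R a b × Chain b xs

  Chain? : ∀ a xs → Dec (Chain a xs)
  Chain? a []       = U? a ×-dec E? a
  Chain? a (b ∷ xs) = U? a ×-dec R? a b ×-dec Chain? b xs

  chains : ℕ → ℕ → ℕ
  chains a zero    = when (U? a ×-dec E? a) 1
  chains a (suc t) = when (U? a) (Σ< a (λ i → when (R? a (suc i)) (chains (suc i) t)))

  chains-¬U : ∀ {a} t → ¬ U a → chains a t ≡ 0
  chains-¬U {a} zero    ¬u = trans (when-× (U? a) (E? a) 1) (when-no (U? a) ¬u _)
  chains-¬U {a} (suc t) ¬u = when-no (U? a) ¬u _

  chains-from-0 : ∀ t → chains 0 t ≡ 0
  chains-from-0 t = chains-¬U t (λ u → 1+n≰n (U⇒pos u))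

  ChainOfLength : ℕ → ℕ → Pred (List ℕ) 0ℓ
  ChainOfLength a t xs = Chain a xs × length xs ≡ t

  chainOfLength? : ∀ a t → Decidable (ChainOfLength a t)
  chainOfLength? a t xs = Chain? a xs ×-dec (length xs ≟ t)

  count-chains : ∀ m l a t → a ≤ m → count (chainOfLength? a t) (listsUpTo m l) ≡ when (t ≤? l) (chains a t)
  count-chains m zero a zero _ =
    trans (count-singleton (chainOfLength? a 0) []) (when-⇔ _ (U? a ×-dec E? a) proj₁ (_, refl) 1)
  count-chains m zero a (suc t) _ =
    trans (count-singleton (chainOfLength? a (suc t)) []) (when-no _ (λ ()) 1)
  count-chains m (suc l) a zero _ = begin
    count (chainOfLength? a 0) (listsUpTo m (suc l))
      ≡⟨ count-listsUpTo m l (chainOfLength? a 0) ⟩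
    when (chainOfLength? a 0 []) 1 + Σ< m (λ i → count (λ xs → chainOfLength? a 0 (suc i ∷ xs)) (listsUpTo m l))
      ≡⟨ cong₂ _+_ (when-⇔ _ (U? a ×-dec E? a) proj₁ (_, refl) 1)
                   (Σ<-zero m (λ i _ → count-none _ (λ xs → 1+n≢0 ∘ proj₂) (listsUpTo m l))) ⟩
    chains a 0 + 0
      ≡⟨ +-identityʳ _ ⟩
    chains a 0 ∎
    where open ≡-Reasoning
  count-chains m (suc l) a (suc t) a≤m = begin
    count (chainOfLength? a (suc t)) (listsUpTo m (suc l))
      ≡⟨ count-listsUpTo m l (chainOfLength? a (suc t)) ⟩
    when (chainOfLength? a (suc t) []) 1 + Σ< m (λ i → count (λ xs → chainOfLength? a (suc t) (suc i ∷ xs)) (listsUpTo m l))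
      ≡⟨ cong₂ _+_ (when-no _ (λ c → 0≢1+n (proj₂ c)) 1) (Σ<-cong m step) ⟩
    Σ< m (λ i → when (t ≤? l) (chainsVia i))
      ≡⟨ Σ<-when m (t ≤? l) chainsVia ⟩
    when (t ≤? l) (Σ< m chainsVia)
      ≡⟨ when-cong (t ≤? l) (suc t ≤? suc l) s≤s s≤s⁻¹ (λ _ → Σ<-when m (U? a) _) ⟩
    when (suc t ≤? suc l) (when (U? a) (Σ< m (λ i → when (R? a (suc i)) (chains (suc i) t))))
      ≡⟨ cong (when (suc t ≤? suc l) ∘ when (U? a)) (Σ<-prefix a m _ a≤m beyond-a) ⟩
    when (suc t ≤? suc l) (chains a (suc t)) ∎
    where
    open ≡-Reasoning
    chainsVia : ℕ → ℕ
    chainsVia i = when (U? a) (when (R? a (suc i)) (chains (suc i) t))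

    beyond-a : ∀ i → a ≤ i → i < m → when (R? a (suc i)) (chains (suc i) t) ≡ 0
    beyond-a i a≤i _ = when-no (R? a (suc i)) (λ r → 1+n≰n (≤-trans (R⇒≥ r) a≤i)) _

    step : ∀ i → i < m → count (λ xs → chainOfLength? a (suc t) (suc i ∷ xs)) (listsUpTo m l) ≡ when (t ≤? l) (chainsVia i)
    step i i<m = begin
      count (λ xs → chainOfLength? a (suc t) (suc i ∷ xs)) (listsUpTo m l)
        ≡⟨ count-cong _ (λ xs → (U? a ×-dec R? a (suc i)) ×-dec chainOfLength? (suc i) t xs)
             (λ ((u , r , c) , len) → (u , r) , c , suc-injective len)
             (λ ((u , r) , c , len) → (u , r , c) , cong suc len) (listsUpTo m l) ⟩
      count (λ xs → (U? a ×-dec R? a (suc i)) ×-dec chainOfLength? (suc i) t xs) (listsUpTo m l)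
        ≡⟨ count-const (U? a ×-dec R? a (suc i)) (chainOfLength? (suc i) t) (listsUpTo m l) ⟩
      when (U? a ×-dec R? a (suc i)) (count (chainOfLength? (suc i) t) (listsUpTo m l))
        ≡⟨ cong (when (U? a ×-dec R? a (suc i))) (count-chains m l (suc i) t i<m) ⟩
      when (U? a ×-dec R? a (suc i)) (when (t ≤? l) (chains (suc i) t))
        ≡⟨ when-× (U? a) (R? a (suc i)) _ ⟩
      when (U? a) (when (R? a (suc i)) (when (t ≤? l) (chains (suc i) t)))
        ≡⟨ cong (when (U? a)) (when-comm (R? a (suc i)) (t ≤? l) _) ⟩
      when (U? a) (when (t ≤? l) (when (R? a (suc i)) (chains (suc i) t)))
        ≡⟨ when-comm (U? a) (t ≤? l) _ ⟩
      when (t ≤? l) (chainsVia i) ∎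

  -- A partition with Γ = n and largest part i+1 has n ∸ (i+1) further parts.
  hookSumOn : {P : Pred ℕ 0ℓ} → Decidable P → ℕ → ℕ
  hookSumOn P? n = Σ< n (λ i → when (P? (suc i)) (chains (suc i) (n ∸ suc i)))

  hookSum : ℕ → ℕ
  hookSum = hookSumOn {λ _ → ⊤} (λ _ → yes tt)

  -- the number of chains with largest part i, j parts and Γ = k
  shapeCount : ℕ → ℕ → ℕ → ℕ
  shapeCount i zero    k = 0
  shapeCount i (suc t) k = when (i + t ≟ k) (chains i t)

  count-candidates : ∀ n {Q : Pred (List ℕ) 0ℓ} (Q? : Decidable Q) {K : Pred ℕ 0ℓ} (K? : Decidable K) → ¬ Q [] →
    (∀ {i xs} → i < n → Q (suc i ∷ xs) → ChainOfLength (suc i) (n ∸ suc i) xs × K i) →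
    (∀ {i xs} → i < n → ChainOfLength (suc i) (n ∸ suc i) xs × K i → Q (suc i ∷ xs)) →
    count Q? (candidates n) ≡ Σ< n (λ i → when (K? i) (chains (suc i) (n ∸ suc i)))
  count-candidates zero    Q? K? ¬Q[] _ _ = trans (count-singleton Q? []) (when-no (Q? []) ¬Q[] 1)
  count-candidates (suc n) Q? K? ¬Q[] Q⇒ ⇒Q = begin
    count Q? (listsUpTo (suc n) (suc n))
      ≡⟨ count-listsUpTo (suc n) n Q? ⟩
    when (Q? []) 1 + Σ< (suc n) (λ i → count (λ xs → Q? (suc i ∷ xs)) (listsUpTo (suc n) n))
      ≡⟨ cong₂ _+_ (when-no (Q? []) ¬Q[] 1) (Σ<-cong (suc n) top) ⟩
    Σ< (suc n) (λ i → when (K? i) (chains (suc i) (n ∸ i))) ∎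
    where
    open ≡-Reasoning
    top : ∀ i → i < suc n → count (λ xs → Q? (suc i ∷ xs)) (listsUpTo (suc n) n) ≡ when (K? i) (chains (suc i) (n ∸ i))
    top i i<n = begin
      count (λ xs → Q? (suc i ∷ xs)) (listsUpTo (suc n) n)
        ≡⟨ count-cong _ (λ xs → K? i ×-dec chainOfLength? (suc i) (n ∸ i) xs)
             (λ q → let (c , k) = Q⇒ i<n q in k , c) (λ (k , c) → ⇒Q i<n (c , k)) (listsUpTo (suc n) n) ⟩
      count (λ xs → K? i ×-dec chainOfLength? (suc i) (n ∸ i) xs) (listsUpTo (suc n) n)
        ≡⟨ count-const (K? i) (chainOfLength? (suc i) (n ∸ i)) (listsUpTo (suc n) n) ⟩
      when (K? i) (count (chainOfLength? (suc i) (n ∸ i)) (listsUpTo (suc n) n))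
        ≡⟨ cong (when (K? i)) (count-chains (suc n) n (suc i) (n ∸ i) i<n) ⟩
      when (K? i) (when (n ∸ i ≤? n) (chains (suc i) (n ∸ i)))
        ≡⟨ cong (when (K? i)) (when-yes (n ∸ i ≤? n) (m∸n≤m n i) _) ⟩
      when (K? i) (chains (suc i) (n ∸ i)) ∎

  hookSumOn-suc : ∀ {P : Pred ℕ 0ℓ} (P? : Decidable P) n →
    hookSumOn P? (suc n) ≡ Σ< n (λ i → when (P? (suc i)) (chains (suc i) (suc (n ∸ suc i)))) + when (P? (suc n)) (chains (suc n) 0)
  hookSumOn-suc P? n = begin
    Σ< (suc n) (λ i → G i (n ∸ i))
      ≡⟨ Σ<-snoc n (λ i → G i (n ∸ i)) ⟩
    Σ< n (λ i → G i (n ∸ i)) + G n (n ∸ n)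
      ≡⟨ cong₂ _+_ (Σ<-cong n (λ i i<n → cong (G i) (m>n⇒m∸n≡1+[m∸1+n] i<n))) (cong (G n) (n∸n≡0 n)) ⟩
    Σ< n (λ i → G i (suc (n ∸ suc i))) + G n 0 ∎
    where
    open ≡-Reasoning
    G : ℕ → ℕ → ℕ
    G i t = when (P? (suc i)) (chains (suc i) t)

  hookSum-suc : ∀ n → hookSum (suc n) ≡ Σ< n (λ i → chains (suc i) (suc (n ∸ suc i))) + chains (suc n) 0
  hookSum-suc = hookSumOn-suc (λ _ → yes tt)

  -- The first c terms vanish because they start at part 0.
  Σ<-chains-shift : ∀ n c {P Q : Pred ℕ 0ℓ} (P? : Decidable P) (Q? : Decidable Q) →
    (∀ j → P (suc j + c) → Q (suc j)) → (∀ j → Q (suc j) → P (suc j + c)) →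
    Σ< n (λ i → when (P? (suc i)) (chains (suc i ∸ c) (n ∸ suc i))) ≡ hookSumOn Q? (n ∸ c)
  Σ<-chains-shift n c {P} P? Q? P⇒Q Q⇒P = trans
    (Σ<-drop n c _ (λ i i<c → trans (cong (λ a → when (P? (suc i)) (chains a (n ∸ suc i))) (m≤n⇒m∸n≡0 i<c))
                                     (trans (cong (when (P? (suc i))) (chains-from-0 (n ∸ suc i))) (when-zero (P? (suc i))))))
    (Σ<-cong (n ∸ c) (λ j _ → when-cong (P? (suc (c + j))) (Q? (suc j))
       (λ p → P⇒Q j (subst P (reorder j) p)) (λ q → subst P (sym (reorder j)) (Q⇒P j q))
       (λ _ → cong₂ chains (trans (+-∸-assoc 1 (m≤m+n c j)) (cong suc (m+n∸m≡n c j)))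
                          (sym (trans (∸-+-assoc n c (suc j)) (cong (n ∸_) (+-suc c j)))))))
    where
    reorder : ∀ j → suc (c + j) ≡ suc j + c
    reorder j = cong suc (+-comm c j)

  hookSum-shift : ∀ n c → Σ< n (λ i → chains (suc i ∸ c) (n ∸ suc i)) ≡ hookSum (n ∸ c)
  hookSum-shift n c = Σ<-chains-shift n c {λ _ → ⊤} {λ _ → ⊤} (λ _ → yes tt) (λ _ → yes tt) (λ _ _ → tt) (λ _ _ → tt)

  module Partitions (P : Pred (List ℕ) 0ℓ) (P? : Decidable P)
    (P⇒Chain : ∀ {a xs} → IsPartition (a ∷ xs) → P (a ∷ xs) → Chain a xs)
    (Chain⇒P : ∀ {a xs} → Chain a xs → IsPartition (a ∷ xs) × P (a ∷ xs)) where

    -- Γ (suc i ∷ xs) reduces to  i + suc (length xs)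
    private
      Γ≡⇒length : ∀ i L n → i + suc L ≡ n → L ≡ n ∸ suc i
      Γ≡⇒length i L n eq = sym (trans (cong (_∸ suc i) (trans (sym eq) (+-suc i L))) (m+n∸m≡n (suc i) L))

      length⇒Γ≡ : ∀ i L n → i < n → L ≡ n ∸ suc i → i + suc L ≡ n
      length⇒Γ≡ i L n i<n refl = trans (+-suc i (n ∸ suc i)) (m+[n∸m]≡n i<n)

      nonEmpty : ∀ {n} {Q : List ℕ → Set} → ¬ PartΓ n Q []
      nonEmpty ((_ , ()) , _)

    count-Γ : ∀ n → #[ n ] P P? ≡ hookSum n
    count-Γ n = count-candidates n (partΓ? n P P?) (λ _ → yes tt) (nonEmpty {Q = P})
      (λ {i} {xs} _ ((π , _) , Γ≡n , p) → (P⇒Chain π p , Γ≡⇒length i (length xs) n Γ≡n) , tt)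
      (λ {i} {xs} i<n ((c , len) , _) → let (π , p) = Chain⇒P c in
         (π , s≤s z≤n) , length⇒Γ≡ i (length xs) n i<n len , p)

    count-shape : ∀ i j k →
      #[ k ] (λ π → P π × (π₁ π ≡ i × ℓ π ≡ j)) (λ π → P? π ×-dec ((π₁ π ≟ i) ×-dec (ℓ π ≟ j)))
      ≡ shapeCount i j k
    count-shape i j k = trans
      (count-candidates k _ (λ x → (suc x ≟ i) ×-dec (suc (k ∸ suc x) ≟ j)) (nonEmpty {Q = λ π → P π × (π₁ π ≡ i × ℓ π ≡ j)})
        (λ {x} {xs} _ ((π , _) , Γ≡k , p , top≡i , len≡j) →
           let len = Γ≡⇒length x (length xs) k Γ≡k in
           (P⇒Chain π p , len) , top≡i , trans (cong suc (sym len)) len≡j)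
        (λ {x} {xs} x<k ((c , len) , top≡i , len≡j) → let (π , p) = Chain⇒P c in
           (π , s≤s z≤n) , length⇒Γ≡ x (length xs) k x<k len , p , top≡i , trans (cong suc len) len≡j))
      (select i j)
      where
      select : ∀ i j → Σ< k (λ x → when ((suc x ≟ i) ×-dec (suc (k ∸ suc x) ≟ j)) (chains (suc x) (k ∸ suc x)))
                       ≡ shapeCount i j k
      select zero    j       = trans (Σ<-zero k (λ x _ → when-no ((suc x ≟ 0) ×-dec (suc (k ∸ suc x) ≟ j)) (1+n≢0 ∘ proj₁) (chains (suc x) (k ∸ suc x)))) (sym (shape-from-0 j))
        where
        shape-from-0 : ∀ j → shapeCount 0 j k ≡ 0
        shape-from-0 zero    = refl
        shape-from-0 (suc t) = trans (cong (when (t ≟ k)) (chains-from-0 t)) (when-zero (t ≟ k))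
      select (suc i) j = begin
        Σ< k (λ x → when ((suc x ≟ suc i) ×-dec (suc (k ∸ suc x) ≟ j)) (chains (suc x) (k ∸ suc x)))
          ≡⟨ Σ<-cong k (λ x _ → trans (when-× (suc x ≟ suc i) _ _)
               (when-cong (suc x ≟ suc i) (x ≟ i) suc-injective (cong suc) (λ { refl → refl }))) ⟩
        Σ< k (λ x → when (x ≟ i) (when (suc (k ∸ suc i) ≟ j) (chains (suc i) (k ∸ suc i))))
          ≡⟨ Σ<-point k i _ ⟩
        when (i <? k) (when (suc (k ∸ suc i) ≟ j) (chains (suc i) (k ∸ suc i)))
          ≡⟨ at-length j ⟩
        shapeCount (suc i) j k ∎
        where
        open ≡-Reasoning
        at-length : ∀ j → when (i <? k) (when (suc (k ∸ suc i) ≟ j) (chains (suc i) (k ∸ suc i))) ≡ shapeCount (suc i) j k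
        at-length zero    = trans (cong (when (i <? k)) (when-no (suc (k ∸ suc i) ≟ 0) 1+n≢0 (chains (suc i) (k ∸ suc i)))) (when-zero (i <? k))
        at-length (suc t) = trans (sym (when-× (i <? k) (suc (k ∸ suc i) ≟ suc t) _))
          (when-cong ((i <? k) ×-dec (suc (k ∸ suc i) ≟ suc t)) (suc i + t ≟ k)
            (λ (i<k , e) → trans (cong (suc i +_) (sym (suc-injective e))) (m+[n∸m]≡n i<k))
            (λ e → subst (suc i ≤_) e (m≤m+n (suc i) t) , cong suc (trans (cong (_∸ suc i) (sym e)) (m+n∸m≡n (suc i) t)))
            (λ (_ , e) → cong (chains (suc i)) (suc-injective e)))

module _ {k : ℕ} where

  %-+-cong : ∀ x y z → x % suc k ≡ y % suc k → (x + z) % suc k ≡ (y + z) % suc k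
  %-+-cong x y z x≡y = begin
    (x + z) % suc k                   ≡⟨ %-distribˡ-+ x z (suc k) ⟩
    (x % suc k + z % suc k) % suc k   ≡⟨ cong (λ r → (r + z % suc k) % suc k) x≡y ⟩
    (y % suc k + z % suc k) % suc k   ≡⟨ %-distribˡ-+ y z (suc k) ⟨
    (y + z) % suc k                   ∎
    where open ≡-Reasoning

  -- adding  z * k  more turns  + z  into a multiple of the modulus
  %-+-cancel : ∀ x y z → (x + z) % suc k ≡ (y + z) % suc k → x % suc k ≡ y % suc k
  %-+-cancel x y z x+z≡y+z = begin
    x % suc k                     ≡⟨ absorb x ⟨
    (x + z + z * k) % suc k       ≡⟨ %-+-cong (x + z) (y + z) (z * k) x+z≡y+z ⟩
    (y + z + z * k) % suc k       ≡⟨ absorb y ⟩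
    y % suc k                     ∎
    where
    open ≡-Reasoning
    absorb : ∀ w → (w + z + z * k) % suc k ≡ w % suc k
    absorb w = trans (cong (_% suc k) (regroup w z k)) ([m+kn]%n≡m%n w z (suc k))
      where
      regroup : ∀ w z k → w + z + z * k ≡ w + z * suc k
      regroup = solve-∀

HookRecurrence : ℕ → (ℕ → ℕ) → Set
HookRecurrence d X = X 0 ≡ 0 × X 1 ≡ 1 × (∀ n → X (suc (suc n)) ≡ X (suc n) + X (suc n ∸ d))

hookRecurrence-unique : ∀ d (X Y : ℕ → ℕ) → HookRecurrence d X → HookRecurrence d Y → ∀ n → X n ≡ Y n
hookRecurrence-unique d X Y (X0 , X1 , Xrec) (Y0 , Y1 , Yrec) n = below n n ≤-refl
  where
  below : ∀ n m → m ≤ n → X m ≡ Y m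
  below n             zero          _       = trans X0 (sym Y0)
  below n             (suc zero)    _       = trans X1 (sym Y1)
  below (suc n) (suc (suc m)) (s≤s m<n) = begin
    X (suc (suc m))            ≡⟨ Xrec m ⟩
    X (suc m) + X (suc m ∸ d)  ≡⟨ cong₂ _+_ (below n (suc m) m<n) (below n (suc m ∸ d) (≤-trans (m∸n≤m (suc m) d) m<n)) ⟩
    Y (suc m) + Y (suc m ∸ d)  ≡⟨ Yrec m ⟨
    Y (suc (suc m))            ∎
    where open ≡-Reasoning

module Family-h (d : ℕ) where
  open Chains (1 ≤_) (1 ≤?_) (λ a b → b ≤ a × d ≤ a ∸ b) (λ a b → (b ≤? a) ×-dec (d ≤? a ∸ b))
              (λ _ → ⊤) (λ _ → yes tt) id proj₁ public

  private
    chain-bounded : ∀ {a xs} → Chain a xs → All (_≤ a) xs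
    chain-bounded {xs = []}     _                 = []
    chain-bounded {xs = b ∷ xs} (_ , (b≤a , _) , c) = b≤a ∷ All.map (λ x≤b → ≤-trans x≤b b≤a) (chain-bounded c)

    P⇒Chain : ∀ {a xs} → IsPartition (a ∷ xs) → DiffAtLeast d (a ∷ xs) → Chain a xs
    P⇒Chain {xs = []}     (_ , 1≤a ∷ _)          _                = 1≤a , tt
    P⇒Chain {xs = b ∷ xs} (b≤a ∷ lk , 1≤a ∷ ps) ((gap ∷ _) ∷ ap) = 1≤a , (b≤a , gap) , P⇒Chain (lk , ps) ap

    Chain⇒P : ∀ {a xs} → Chain a xs → IsPartition (a ∷ xs) × DiffAtLeast d (a ∷ xs)
    Chain⇒P {xs = []}     (1≤a , _)               = ([-] , 1≤a ∷ []) , [] ∷ []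
    Chain⇒P {a} {b ∷ xs} (1≤a , (b≤a , gap) , c) =
      let ((lk , ps) , ap) = Chain⇒P c in
      (b≤a ∷ lk , 1≤a ∷ ps) , (gap ∷ All.map (λ x≤b → ≤-trans gap (∸-monoʳ-≤ a x≤b)) (chain-bounded c)) ∷ ap

  open Partitions (DiffAtLeast d) (DiffAtLeast? d) P⇒Chain Chain⇒P public

  chains-suc : ∀ a t → chains a (suc t) ≡ Σ< (a ∸ d) (λ i → chains (suc i) t)
  chains-suc zero    t = cong (λ n → Σ< n (λ i → chains (suc i) t)) (sym (0∸n≡0 d))
  chains-suc (suc a) t = Σ<-restrict (suc a) (suc a ∸ d) (λ i → (suc i ≤? suc a) ×-dec (d ≤? a ∸ i))
    (λ i → chains (suc i) t) (m∸n≤m (suc a) d) gap⇒below below⇒gap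
    where
    <∸⇒+< : ∀ {i} → i < suc a ∸ d → suc i + d ≤ suc a
    <∸⇒+< {i} lt = m≤o∸n⇒m+n≤o (suc i) (<⇒≤ (m∸n≢0⇒n<m (λ eq → n≮0 (subst (suc i ≤_) eq lt)))) lt
    gap⇒below : ∀ i → i < suc a → suc i ≤ suc a × d ≤ a ∸ i → i < suc a ∸ d
    gap⇒below i (s≤s i≤a) (_ , gap) = m+n≤o⇒m≤o∸n (suc i) (s≤s (subst (_≤ a) (+-comm d i) (m≤o∸n⇒m+n≤o d i≤a gap)))
    below⇒gap : ∀ i → i < suc a ∸ d → suc i ≤ suc a × d ≤ a ∸ i
    below⇒gap i lt = let i+d≤a = s≤s⁻¹ (<∸⇒+< lt) in
      s≤s (≤-trans (m≤m+n i d) i+d≤a) , m+n≤o⇒m≤o∸n d (subst (_≤ a) (+-comm i d) i+d≤a)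

  chains-suc-top : ∀ a t → chains (suc a) (suc t) ≡ chains a (suc t) + chains (suc a ∸ d) t
  chains-suc-top a t = by-cases (d ≤? a)
    where
    open ≡-Reasoning
    G : ℕ → ℕ
    G i = chains (suc i) t

    by-cases : Dec (d ≤ a) → chains (suc a) (suc t) ≡ chains a (suc t) + chains (suc a ∸ d) t
    by-cases (yes d≤a) = begin
      chains (suc a) (suc t)           ≡⟨ chains-suc (suc a) t ⟩
      Σ< (suc a ∸ d) G                 ≡⟨ cong (λ n → Σ< n G) (+-∸-assoc 1 d≤a) ⟩
      Σ< (suc (a ∸ d)) G               ≡⟨ Σ<-snoc (a ∸ d) G ⟩
      Σ< (a ∸ d) G + G (a ∸ d)         ≡⟨ cong₂ _+_ (chains-suc a t) (cong (λ b → chains b t) (+-∸-assoc 1 d≤a)) ⟨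
      chains a (suc t) + chains (suc a ∸ d) t ∎
    by-cases (no d≰a) = begin
      chains (suc a) (suc t)           ≡⟨ chains-suc (suc a) t ⟩
      Σ< (suc a ∸ d) G                 ≡⟨ cong (λ n → Σ< n G) a+1∸d≡0 ⟩
      0                                ≡⟨ cong₂ _+_ (trans (chains-suc a t) (cong (λ n → Σ< n G) (m≤n⇒m∸n≡0 (<⇒≤ (≰⇒> d≰a)))))
                                                    (trans (cong (λ b → chains b t) a+1∸d≡0) (chains-from-0 t)) ⟨
      chains a (suc t) + chains (suc a ∸ d) t ∎
      where a+1∸d≡0 = m≤n⇒m∸n≡0 (≰⇒> d≰a)

  hookSum-recurrence : HookRecurrence d hookSum
  hookSum-recurrence = refl , refl , λ n → begin
    hookSum (suc (suc n))
      ≡⟨ hookSum-suc (suc n) ⟩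
    Σ< (suc n) (λ i → chains (suc i) (suc (n ∸ i))) + 1
      ≡⟨ cong (_+ 1) (Σ<-cong (suc n) (λ i _ → chains-suc-top i (n ∸ i))) ⟩
    Σ< (suc n) (λ i → chains i (suc (n ∸ i)) + chains (suc i ∸ d) (n ∸ i)) + 1
      ≡⟨ cong (_+ 1) (Σ<-+ (suc n) (λ i → chains i (suc (n ∸ i))) (λ i → chains (suc i ∸ d) (n ∸ i))) ⟩
    chains 0 (suc n) + Σ< n (λ i → chains (suc i) (suc (n ∸ suc i))) + Σ< (suc n) (λ i → chains (suc i ∸ d) (n ∸ i)) + 1
      ≡⟨ rearrange (chains 0 (suc n)) (Σ< n (λ i → chains (suc i) (suc (n ∸ suc i)))) (Σ< (suc n) (λ i → chains (suc i ∸ d) (n ∸ i))) 1 ⟩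
    chains 0 (suc n) + (Σ< n (λ i → chains (suc i) (suc (n ∸ suc i))) + 1) + Σ< (suc n) (λ i → chains (suc i ∸ d) (n ∸ i))
      ≡⟨ cong₂ _+_ (cong₂ _+_ (chains-from-0 (suc n)) (sym (hookSum-suc n))) (hookSum-shift (suc n) d) ⟩
    hookSum (suc n) + hookSum (suc n ∸ d) ∎
    where
    open ≡-Reasoning
    rearrange : ∀ a b c e → a + b + c + e ≡ a + (b + e) + c
    rearrange = solve-∀

module Family-f (d : ℕ) where
  OneMod : Pred ℕ 0ℓ
  OneMod a = 1 ≤ a × a % suc d ≡ 1 % suc d

  oneMod? : Decidable OneMod
  oneMod? a = (1 ≤? a) ×-dec (a % suc d ≟ 1 % suc d)

  open Chains OneMod oneMod? (λ a b → b ≤ a) (λ a b → b ≤? a) (λ _ → ⊤) (λ _ → yes tt) proj₁ id public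

  private
    P⇒Chain : ∀ {a xs} → IsPartition (a ∷ xs) → AllOneMod d (a ∷ xs) → Chain a xs
    P⇒Chain {xs = []}     (_ , 1≤a ∷ _)          (r ∷ _)  = (1≤a , r) , tt
    P⇒Chain {xs = b ∷ xs} (b≤a ∷ lk , 1≤a ∷ ps) (r ∷ rs) = (1≤a , r) , b≤a , P⇒Chain (lk , ps) rs

    Chain⇒P : ∀ {a xs} → Chain a xs → IsPartition (a ∷ xs) × AllOneMod d (a ∷ xs)
    Chain⇒P {xs = []}     ((1≤a , r) , _)       = ([-] , 1≤a ∷ []) , r ∷ []
    Chain⇒P {xs = b ∷ xs} ((1≤a , r) , b≤a , c) =
      let ((lk , ps) , rs) = Chain⇒P c in (b≤a ∷ lk , 1≤a ∷ ps) , r ∷ rs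

  open Partitions (AllOneMod d) (AllOneMod? d) P⇒Chain Chain⇒P public

  module _ (d≥1 : 1 ≤ d) where

    private
      1%[1+d]≡1 : 1 % suc d ≡ 1
      1%[1+d]≡1 = m<n⇒m%n≡m (s≤s d≥1)

      %≡1⇒oneMod : ∀ a → a % suc d ≡ 1 % suc d → OneMod a
      %≡1⇒oneMod zero    eq = ⊥-elim (0≢1+n (trans eq 1%[1+d]≡1))
      %≡1⇒oneMod (suc a) eq = s≤s z≤n , eq

      ¬oneMod-small : ∀ {a} → 2 ≤ a → a ≤ suc d → ¬ OneMod a
      ¬oneMod-small {a} 2≤a a≤1+d (_ , eq) with m≤n⇒m<n∨m≡n a≤1+d
      ... | inj₁ a<1+d = <⇒≢ 2≤a (sym (trans (sym (m<n⇒m%n≡m a<1+d)) (trans eq 1%[1+d]≡1)))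
      ... | inj₂ refl  = 0≢1+n (trans (sym (n%n≡0 (suc d))) (trans eq 1%[1+d]≡1))

      oneMod-period⁻ : ∀ c → OneMod (c + suc d) → OneMod c
      oneMod-period⁻ c (_ , eq) = %≡1⇒oneMod c (trans (sym ([m+n]%n≡m%n c (suc d))) eq)

      oneMod-period⁺ : ∀ c → OneMod c → OneMod (c + suc d)
      oneMod-period⁺ c (1≤c , eq) = ≤-trans 1≤c (m≤m+n c (suc d)) , trans ([m+n]%n≡m%n c (suc d)) eq

      window : ∀ {c j} → OneMod c → j < d → ¬ OneMod (suc (c + j))
      window {c} {j} (_ , c≡1) j<d u = ¬oneMod-small (s≤s (s≤s z≤n)) (s≤s j<d)
        (s≤s z≤n , trans (sym (trans (cong (_% suc d) (sym (+-suc c j))) (%-+-cong c 1 (suc j) c≡1))) (proj₂ u))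

    chains-suc : ∀ a t → chains a (suc t) ≡ when (oneMod? a) (Σ< a (λ i → chains (suc i) t))
    chains-suc a t = cong (when (oneMod? a)) (Σ<-cong a (λ i i<a → when-yes (suc i ≤? a) i<a _))

    private
      chains-suc-above : ∀ c t → chains (c + suc d) (suc t) ≡ chains (c + suc d) t + chains c (suc t)
      chains-suc-above c t = by-cases (oneMod? (c + suc d))
        where
        open ≡-Reasoning
        G : ℕ → ℕ
        G i = chains (suc i) t

        by-cases : Dec (OneMod (c + suc d)) → chains (c + suc d) (suc t) ≡ chains (c + suc d) t + chains c (suc t)
        by-cases (no ¬u) = begin
          chains (c + suc d) (suc t)               ≡⟨ chains-¬U (suc t) ¬u ⟩
          0                                        ≡⟨ cong₂ _+_ (chains-¬U t ¬u) (chains-¬U (suc t) (¬u ∘ oneMod-period⁺ c)) ⟨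
          chains (c + suc d) t + chains c (suc t)  ∎
        by-cases (yes u) = begin
          chains (c + suc d) (suc t)                      ≡⟨ chains-suc (c + suc d) t ⟩
          when (oneMod? (c + suc d)) (Σ< (c + suc d) G)   ≡⟨ when-yes (oneMod? (c + suc d)) u _ ⟩
          Σ< (c + suc d) G                                ≡⟨ Σ<-split c (suc d) G ⟩
          Σ< c G + Σ< (suc d) (λ j → G (c + j))          ≡⟨ cong (Σ< c G +_) (Σ<-snoc d (λ j → G (c + j))) ⟩
          Σ< c G + (Σ< d (λ j → G (c + j)) + G (c + d))
            ≡⟨ cong₂ _+_ (sym (trans (chains-suc c t) (when-yes (oneMod? c) uc _)))
                         (cong₂ _+_ (Σ<-zero d (λ j j<d → chains-¬U t (window uc j<d)))
                                    (cong (λ b → chains b t) (sym (+-suc c d)))) ⟩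
          chains c (suc t) + chains (c + suc d) t         ≡⟨ +-comm (chains c (suc t)) _ ⟩
          chains (c + suc d) t + chains c (suc t)         ∎
          where uc = oneMod-period⁻ c u

      chains-suc-below : ∀ a t → a ≤ d → chains a (suc t) ≡ chains a t
      chains-suc-below zero          t _    = trans (chains-from-0 (suc t)) (sym (chains-from-0 t))
      chains-suc-below (suc zero)    t _    with oneMod? 1
      ... | yes _ = +-identityʳ _
      ... | no ¬u = sym (chains-¬U t ¬u)
      chains-suc-below (suc (suc a)) t a≤d =
        trans (chains-¬U (suc t) ¬u) (sym (chains-¬U t ¬u))
        where ¬u = ¬oneMod-small (s≤s (s≤s z≤n)) (m≤n⇒m≤1+n a≤d)

    chains-suc-periodic : ∀ a t → chains a (suc t) ≡ chains a t + chains (a ∸ suc d) (suc t)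
    chains-suc-periodic a t with suc d ≤? a
    ... | yes 1+d≤a = subst (λ b → chains b (suc t) ≡ chains b t + chains (a ∸ suc d) (suc t))
                            (m∸n+n≡m 1+d≤a) (chains-suc-above (a ∸ suc d) t)
    ... | no  1+d≰a = begin
      chains a (suc t)                         ≡⟨ chains-suc-below a t (s≤s⁻¹ (≰⇒> 1+d≰a)) ⟩
      chains a t                               ≡⟨ +-identityʳ _ ⟨
      chains a t + 0                           ≡⟨ cong (λ b → chains a t + chains b (suc t)) (m≤n⇒m∸n≡0 (<⇒≤ (≰⇒> 1+d≰a))) ⟨
      chains a t + chains (a ∸ suc d) (suc t)  ∎
      where open ≡-Reasoning

    private
      oneMod-∸-period : ∀ {a} → 2 ≤ a → (OneMod (a ∸ suc d) → OneMod a) × (OneMod a → OneMod (a ∸ suc d))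
      oneMod-∸-period {a} 2≤a with suc d ≤? a
      ... | yes 1+d≤a = (λ u → subst OneMod (m∸n+n≡m 1+d≤a) (oneMod-period⁺ (a ∸ suc d) u))
                      , (λ u → oneMod-period⁻ (a ∸ suc d) (subst OneMod (sym (m∸n+n≡m 1+d≤a)) u))
      ... | no  1+d≰a = (λ u → ⊥-elim (1+n≰n (subst (1 ≤_) (m≤n⇒m∸n≡0 (<⇒≤ (≰⇒> 1+d≰a))) (proj₁ u))))
                      , (λ u → ⊥-elim (¬oneMod-small 2≤a (<⇒≤ (≰⇒> 1+d≰a)) u))

      chains₀-periodic : ∀ {a} → 2 ≤ a → chains (a ∸ suc d) 0 ≡ chains a 0
      chains₀-periodic 2≤a = let (⇒ , ⇐) = oneMod-∸-period 2≤a in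
        when-⇔ _ _ (λ (u , _) → ⇒ u , tt) (λ (u , _) → ⇐ u , tt) 1

    hookSum-recurrence : HookRecurrence d hookSum
    hookSum-recurrence = refl , trans (+-identityʳ _) (when-yes (oneMod? 1 ×-dec yes tt) ((s≤s z≤n , refl) , tt) 1) , step
      where
      step : ∀ n → hookSum (suc (suc n)) ≡ hookSum (suc n) + hookSum (suc n ∸ d)
      step n = begin
        hookSum (suc (suc n))
          ≡⟨ hookSum-suc (suc n) ⟩
        Σ< (suc n) (λ i → chains (suc i) (suc (n ∸ i))) + chains (suc (suc n)) 0
          ≡⟨ cong (_+ chains (suc (suc n)) 0) (Σ<-cong (suc n) (λ i _ → chains-suc-periodic (suc i) (n ∸ i))) ⟩
        Σ< (suc n) (λ i → chains (suc i) (n ∸ i) + chains (suc i ∸ suc d) (suc (n ∸ i))) + chains (suc (suc n)) 0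
          ≡⟨ cong (_+ chains (suc (suc n)) 0) (Σ<-+ (suc n) (λ i → chains (suc i) (n ∸ i)) (λ i → chains (suc i ∸ suc d) (suc (n ∸ i)))) ⟩
        hookSum (suc n) + Σ< (suc n) (λ i → chains (suc i ∸ suc d) (suc (n ∸ i))) + chains (suc (suc n)) 0
          ≡⟨ +-assoc (hookSum (suc n)) _ _ ⟩
        hookSum (suc n) + (Σ< (suc n) (λ i → chains (suc i ∸ suc d) (suc (n ∸ i))) + chains (suc (suc n)) 0)
          ≡⟨ cong (hookSum (suc n) +_) tail ⟩
        hookSum (suc n) + hookSum (suc n ∸ d) ∎
        where
        open ≡-Reasoning
        tail : Σ< (suc n) (λ i → chains (suc i ∸ suc d) (suc (n ∸ i))) + chains (suc (suc n)) 0 ≡ hookSum (suc n ∸ d)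
        tail = begin
          Σ< (suc n) (λ i → chains (suc i ∸ suc d) (suc (n ∸ i))) + chains (suc (suc n)) 0
            ≡⟨ cong₂ _+_ (Σ<-cong (suc n) (λ i i<1+n → cong (chains (suc i ∸ suc d)) (sym (+-∸-assoc 1 (s≤s⁻¹ i<1+n)))))
                         (trans (sym (chains₀-periodic (s≤s (s≤s z≤n)))) (cong (chains (suc (suc n) ∸ suc d)) (sym (n∸n≡0 n)))) ⟩
          Σ< (suc n) (λ i → chains (suc i ∸ suc d) (suc n ∸ i)) + chains (suc (suc n) ∸ suc d) (n ∸ n)
            ≡⟨ Σ<-snoc (suc n) (λ i → chains (suc i ∸ suc d) (suc n ∸ i)) ⟨
          Σ< (suc (suc n)) (λ i → chains (suc i ∸ suc d) (suc n ∸ i))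
            ≡⟨ hookSum-shift (suc (suc n)) (suc d) ⟩
          hookSum (suc n ∸ d) ∎


module Family-g (d : ℕ) where
  Allowed : Pred ℕ 0ℓ
  Allowed a = 1 ≤ a × ResidueOK d a

  allowed? : Decidable Allowed
  allowed? a = (1 ≤? a) ×-dec ((a % M d ≟ 1 % M d) ⊎-dec (a % M d ≟ (d + 2) % M d))

  gapOK? : ∀ a b → Dec (GapOK d a b)
  gapOK? a b = (a ∸ b ≤? M d) ×-dec ((a % M d ≟ 1 % M d) →-dec (a ∸ b <? M d))

  open Chains Allowed allowed? (λ a b → b ≤ a × GapOK d a b) (λ a b → (b ≤? a) ×-dec gapOK? a b)
              (λ a → GapOK d a 0) (λ a → gapOK? a 0) proj₁ proj₁ public

  private
    P⇒Chain : ∀ {a xs} → IsPartition (a ∷ xs) → InG d (a ∷ xs) → Chain a xs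
    P⇒Chain {xs = []}     (_ , 1≤a ∷ _)          (r ∷ _ , gap ∷ _)    = (1≤a , r) , gap
    P⇒Chain {xs = b ∷ xs} (b≤a ∷ lk , 1≤a ∷ ps) (r ∷ rs , gap ∷ gaps) = (1≤a , r) , (b≤a , gap) , P⇒Chain (lk , ps) (rs , gaps)

    Chain⇒P : ∀ {a xs} → Chain a xs → IsPartition (a ∷ xs) × InG d (a ∷ xs)
    Chain⇒P {xs = []}     ((1≤a , r) , gap)             = ([-] , 1≤a ∷ []) , r ∷ [] , gap ∷ [-]
    Chain⇒P {xs = b ∷ xs} ((1≤a , r) , (b≤a , gap) , c) =
      let ((lk , ps) , rs , gaps) = Chain⇒P c in (b≤a ∷ lk , 1≤a ∷ ps) , r ∷ rs , gap ∷ gaps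

  open Partitions (InG d) (InG? d) P⇒Chain Chain⇒P public

module Family-g-recursions (d : ℕ) (d≥1 : 1 ≤ d) where
  open Family-g d

  Res₁ Res₂ : Pred ℕ 0ℓ
  Res₁ a = a % M d ≡ 1 % M d
  Res₂ a = a % M d ≡ (d + 2) % M d

  res₁? : Decidable Res₁
  res₁? a = a % M d ≟ 1 % M d

  res₂? : Decidable Res₂
  res₂? a = a % M d ≟ (d + 2) % M d

  private
    M≡1+d+d : M d ≡ suc d + d
    M≡1+d+d = lemma d where
      lemma : ∀ d → suc (2 * d) ≡ suc d + d
      lemma = solve-∀

    1+d<M : suc d < M d
    1+d<M = subst (suc d <_) (sym M≡1+d+d) (m<m+n (suc d) d≥1)

    d+2≤M : d + 2 ≤ M d
    d+2≤M = subst (_≤ M d) (+-comm 2 d) 1+d<M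

    1≤d+2 : 1 ≤ d + 2
    1≤d+2 = subst (1 ≤_) (+-comm 2 d) (s≤s z≤n)

    d<M : d < M d
    d<M = <-trans (n<1+n d) 1+d<M

    1<M : 1 < M d
    1<M = ≤-<-trans d≥1 d<M

    1%M≡1 : 1 % M d ≡ 1
    1%M≡1 = m<n⇒m%n≡m 1<M

    %-injective : ∀ {x y} → x ≤ M d → y < M d → x % M d ≡ y % M d → x ≡ y ⊎ (x ≡ M d × y ≡ 0)
    %-injective {x} {y} x≤M y<M eq with m≤n⇒m<n∨m≡n x≤M
    ... | inj₁ x<M = inj₁ (trans (sym (m<n⇒m%n≡m x<M)) (trans eq (m<n⇒m%n≡m y<M)))
    ... | inj₂ refl = inj₂ (refl , trans (sym (m<n⇒m%n≡m y<M)) (trans (sym eq) (n%n≡0 (M d))))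

    %-injective-pos : ∀ {x y} → 1 ≤ x → 1 ≤ y → x ≤ M d → y ≤ M d → x % M d ≡ y % M d → x ≡ y
    %-injective-pos 1≤x 1≤y x≤M y≤M eq with m≤n⇒m<n∨m≡n y≤M | m≤n⇒m<n∨m≡n x≤M
    ... | inj₁ y<M | _        = [ id , (λ (_ , y≡0) → ⊥-elim (m<n⇒n≢0 1≤y y≡0)) ]′ (%-injective x≤M y<M eq)
    ... | inj₂ _   | inj₁ x<M = [ sym , (λ (_ , x≡0) → ⊥-elim (m<n⇒n≢0 1≤x x≡0)) ]′ (%-injective y≤M x<M (sym eq))
    ... | inj₂ y≡M | inj₂ x≡M = trans x≡M (sym y≡M)

    res-shift⁺ : ∀ {b c r s} → (r + c) % M d ≡ s % M d → b % M d ≡ r % M d → (b + c) % M d ≡ s % M d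
    res-shift⁺ {b} {c} {r} r+c≡s b≡r = trans (%-+-cong b r c b≡r) r+c≡s

    res-shift⁻ : ∀ {b c r s} → (r + c) % M d ≡ s % M d → (b + c) % M d ≡ s % M d → b % M d ≡ r % M d
    res-shift⁻ {b} {c} {r} r+c≡s b+c≡s = %-+-cancel b r c (trans b+c≡s (sym r+c≡s))

    d+2+d≡1 : (d + 2 + d) % M d ≡ 1 % M d
    d+2+d≡1 = trans (cong (_% M d) (lemma d)) ([m+n]%n≡m%n 1 (M d))
      where
      lemma : ∀ d → d + 2 + d ≡ 1 + suc (2 * d)
      lemma = solve-∀

    1+[1+d]≡d+2 : (1 + suc d) % M d ≡ (d + 2) % M d
    1+[1+d]≡d+2 = cong (_% M d) (+-comm 2 d)

  res₂⇒res₁[+d] : ∀ b → Res₂ b → Res₁ (b + d)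
  res₂⇒res₁[+d] b = res-shift⁺ {b} {d} {d + 2} {1} d+2+d≡1

  res₁[+d]⇒res₂ : ∀ b → Res₁ (b + d) → Res₂ b
  res₁[+d]⇒res₂ b = res-shift⁻ {b} {d} {d + 2} {1} d+2+d≡1

  res₁⇒res₂[+1+d] : ∀ b → Res₁ b → Res₂ (b + suc d)
  res₁⇒res₂[+1+d] b = res-shift⁺ {b} {suc d} {1} {d + 2} 1+[1+d]≡d+2

  res₂[+1+d]⇒res₁ : ∀ b → Res₂ (b + suc d) → Res₁ b
  res₂[+1+d]⇒res₁ b = res-shift⁻ {b} {suc d} {1} {d + 2} 1+[1+d]≡d+2

  res-period : ∀ b → (b + M d) % M d ≡ b % M d
  res-period b = [m+n]%n≡m%n b (M d)

  res₁≢res₂ : ∀ a → Res₁ a → ¬ Res₂ a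
  res₁≢res₂ _ r₁ r₂ = 0≢1+n (sym (suc-injective (trans (sym (+-comm d 2)) d+2≡1)))
    where d+2≡1 = %-injective-pos 1≤d+2 ≤-refl d+2≤M (<⇒≤ 1<M) (trans (sym r₂) r₁)

  private
    0<M : 0 < M d
    0<M = s≤s z≤n

    gapOK-intro : ∀ {a b δ} → b + δ ≡ a → δ ≤ M d → (Res₁ a → δ < M d) → GapOK d a b
    gapOK-intro {b = b} {δ} refl δ≤M δ<M = subst (_≤ M d) (sym (m+n∸m≡n b δ)) δ≤M
                                          , subst (_< M d) (sym (m+n∸m≡n b δ)) ∘ δ<M

    gap-residue : ∀ {a b} c → b ≤ a → a % M d ≡ (b + c) % M d → (a ∸ b) % M d ≡ c % M d
    gap-residue {a} {b} c b≤a eq = %-+-cancel (a ∸ b) c b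
      (trans (cong (_% M d) (m∸n+n≡m b≤a)) (trans eq (cong (_% M d) (+-comm b c))))

    gap⇒sum : ∀ {a b c} → b ≤ a → a ∸ b ≡ c → b + c ≡ a
    gap⇒sum b≤a refl = m+[n∸m]≡n b≤a

  step-into-res₁ : ∀ {a b} → Res₁ a → Allowed b → b ≤ a → GapOK d a b → b + 0 ≡ a ⊎ b + d ≡ a
  step-into-res₁ {a} {b} ra (_ , inj₁ rb) b≤a (gap≤M , gap<M) =
    [ inj₁ ∘ gap⇒sum b≤a , (λ (gap≡M , _) → ⊥-elim (<⇒≢ (gap<M ra) gap≡M)) ]′
    (%-injective gap≤M 0<M (gap-residue 0 b≤a (trans ra (trans (sym rb) (cong (_% M d) (sym (+-identityʳ b)))))))
  step-into-res₁ {a} {b} ra (_ , inj₂ rb) b≤a (gap≤M , _) =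
    [ inj₂ ∘ gap⇒sum b≤a , (λ (_ , d≡0) → ⊥-elim (m<n⇒n≢0 d≥1 d≡0)) ]′
    (%-injective gap≤M d<M (gap-residue d b≤a (trans ra (sym (res₂⇒res₁[+d] b rb)))))

  step-into-res₂ : ∀ {a b} → Res₂ a → Allowed b → b ≤ a → GapOK d a b → (b + 0 ≡ a ⊎ b + suc d ≡ a) ⊎ b + M d ≡ a
  step-into-res₂ {a} {b} ra (_ , inj₁ rb) b≤a (gap≤M , _) =
    [ inj₁ ∘ inj₂ ∘ gap⇒sum b≤a , (λ { (_ , ()) }) ]′
    (%-injective gap≤M 1+d<M (gap-residue (suc d) b≤a (trans ra (sym (res₁⇒res₂[+1+d] b rb)))))
  step-into-res₂ {a} {b} ra (_ , inj₂ rb) b≤a (gap≤M , _) =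
    [ inj₁ ∘ inj₁ ∘ gap⇒sum b≤a , (λ (gap≡M , _) → inj₂ (gap⇒sum b≤a gap≡M)) ]′
    (%-injective gap≤M 0<M (gap-residue 0 b≤a (trans ra (trans (sym rb) (cong (_% M d) (sym (+-identityʳ b)))))))

  private
    allowed-res₁ : ∀ {a} → Res₁ a → Allowed a
    allowed-res₁ {zero}  r = ⊥-elim (0≢1+n (trans r 1%M≡1))
    allowed-res₁ {suc a} r = s≤s z≤n , inj₁ r

    when-chains-¬allowed : ∀ {b} t (p? : Dec A) → ¬ Allowed b → when p? (chains b t) ≡ 0
    when-chains-¬allowed t p? ¬ab = trans (cong (when p?) (chains-¬U t ¬ab)) (when-zero p?)

    steps-into-res₁ : ∀ {a b} t → Res₁ a → b ≤ a →
      when ((b ≤? a) ×-dec gapOK? a b) (chains b t) ≡ when (b + 0 ≟ a) (chains b t) + when (b + d ≟ a) (chains b t)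
    steps-into-res₁ {a} {b} t ra b≤a with allowed? b
    ... | no ¬ab = trans (when-chains-¬allowed t _ ¬ab)
                         (sym (cong₂ _+_ (when-chains-¬allowed t (b + 0 ≟ a) ¬ab) (when-chains-¬allowed t (b + d ≟ a) ¬ab)))
    ... | yes ab = when-⊎ _ (b + 0 ≟ a) (b + d ≟ a)
      (λ (b≤a , gap) → step-into-res₁ ra ab b≤a gap)
      (λ e → b≤a , gapOK-intro e z≤n (λ _ → 0<M))
      (λ e → b≤a , gapOK-intro e (<⇒≤ d<M) (λ _ → d<M))
      (λ e₀ e_d → m<n⇒n≢0 d≥1 (+-cancelˡ-≡ b d 0 (trans e_d (sym e₀))))
      (chains b t)

    steps-into-res₂ : ∀ {a b} t → Res₂ a → b ≤ a →
      when ((b ≤? a) ×-dec gapOK? a b) (chains b t)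
        ≡ when (b + 0 ≟ a) (chains b t) + when (b + suc d ≟ a) (chains b t) + when (b + M d ≟ a) (chains b t)
    steps-into-res₂ {a} {b} t ra b≤a with allowed? b
    ... | no ¬ab = trans (when-chains-¬allowed t _ ¬ab)
                         (sym (cong₂ _+_ (cong₂ _+_ (when-chains-¬allowed t (b + 0 ≟ a) ¬ab)
                                                    (when-chains-¬allowed t (b + suc d ≟ a) ¬ab))
                                         (when-chains-¬allowed t (b + M d ≟ a) ¬ab)))
    ... | yes ab = trans
      (when-⊎ _ ((b + 0 ≟ a) ⊎-dec (b + suc d ≟ a)) (b + M d ≟ a)
        (λ (b≤a , gap) → step-into-res₂ ra ab b≤a gap)
        [ (λ e → b≤a , gapOK-intro e z≤n (λ r₁ → ⊥-elim (res₁≢res₂ a r₁ ra)))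
        , (λ e → b≤a , gapOK-intro e (<⇒≤ 1+d<M) (λ r₁ → ⊥-elim (res₁≢res₂ a r₁ ra))) ]′
        (λ e → b≤a , gapOK-intro e ≤-refl (λ r₁ → ⊥-elim (res₁≢res₂ a r₁ ra)))
        [ (λ e₀ e_M → m<n⇒n≢0 0<M (+-cancelˡ-≡ b (M d) 0 (trans e_M (sym e₀))))
        , (λ e₁ e_M → <⇒≢ 1+d<M (+-cancelˡ-≡ b (suc d) (M d) (trans e₁ (sym e_M)))) ]′
        (chains b t))
      (cong (_+ when (b + M d ≟ a) (chains b t))
        (when-⊎ ((b + 0 ≟ a) ⊎-dec (b + suc d ≟ a)) (b + 0 ≟ a) (b + suc d ≟ a) id inj₁ inj₂
          (λ e₀ e₁ → 0≢1+n (+-cancelˡ-≡ b 0 (suc d) (trans e₀ (sym e₁)))) (chains b t)))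

  private
    at : ℕ → ℕ → ℕ → ℕ → ℕ
    at a t δ i = when (suc i + δ ≟ a) (chains (suc i) t)

    Σ<-at : ∀ a t δ → Σ< a (at a t δ) ≡ chains (a ∸ δ) t
    Σ<-at a t δ = Σ<-point-shift a δ (λ b → chains b t) (chains-from-0 t)

  chains-suc-res₁ : ∀ a t → Res₁ a → chains a (suc t) ≡ chains a t + chains (a ∸ d) t
  chains-suc-res₁ a t ra = begin
    chains a (suc t)
      ≡⟨ when-yes (allowed? a) (allowed-res₁ ra) _ ⟩
    Σ< a (λ i → when ((suc i ≤? a) ×-dec gapOK? a (suc i)) (chains (suc i) t))
      ≡⟨ Σ<-cong a (λ i i<a → steps-into-res₁ t ra i<a) ⟩
    Σ< a (λ i → at a t 0 i + at a t d i)
      ≡⟨ Σ<-+ a (at a t 0) (at a t d) ⟩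
    Σ< a (at a t 0) + Σ< a (at a t d)
      ≡⟨ cong₂ _+_ (Σ<-at a t 0) (Σ<-at a t d) ⟩
    chains a t + chains (a ∸ d) t ∎
    where open ≡-Reasoning

  chains-suc-res₂ : ∀ a t → Res₂ a → chains a (suc t) ≡ chains a t + chains (a ∸ suc d) t + chains (a ∸ M d) t
  chains-suc-res₂ zero t _ = sym (trans (cong₂ _+_ (cong₂ _+_ (chains-from-0 t) (chains-from-0 t)) (chains-from-0 t))
                                         (sym (chains-from-0 (suc t))))
  chains-suc-res₂ a@(suc _) t ra = begin
    chains a (suc t)
      ≡⟨ when-yes (allowed? a) (s≤s z≤n , inj₂ ra) _ ⟩
    Σ< a (λ i → when ((suc i ≤? a) ×-dec gapOK? a (suc i)) (chains (suc i) t))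
      ≡⟨ Σ<-cong a (λ i i<a → steps-into-res₂ t ra i<a) ⟩
    Σ< a (λ i → at a t 0 i + at a t (suc d) i + at a t (M d) i)
      ≡⟨ Σ<-+ a (λ i → at a t 0 i + at a t (suc d) i) (at a t (M d)) ⟩
    Σ< a (λ i → at a t 0 i + at a t (suc d) i) + Σ< a (at a t (M d))
      ≡⟨ cong (_+ Σ< a (at a t (M d))) (Σ<-+ a (at a t 0) (at a t (suc d))) ⟩
    Σ< a (at a t 0) + Σ< a (at a t (suc d)) + Σ< a (at a t (M d))
      ≡⟨ cong₂ _+_ (cong₂ _+_ (Σ<-at a t 0) (Σ<-at a t (suc d))) (Σ<-at a t (M d)) ⟩
    chains a t + chains (a ∸ suc d) t + chains (a ∸ M d) t ∎
    where open ≡-Reasoning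

  chains-neither : ∀ a t → ¬ Res₁ a → ¬ Res₂ a → chains a t ≡ 0
  chains-neither _ t ¬r₁ ¬r₂ = chains-¬U t (λ (_ , r) → [ ¬r₁ , ¬r₂ ]′ r)

  chains₀ : ∀ a → chains a 0 ≡ when (a ≟ 1) 1 + when (a ≟ d + 2) 1
  chains₀ a = when-⊎ (allowed? a ×-dec gapOK? a 0) (a ≟ 1) (a ≟ d + 2)
    (λ { ((1≤a , inj₁ r₁) , a≤M , _) → inj₁ (%-injective-pos 1≤a ≤-refl a≤M (<⇒≤ 1<M) r₁)
       ; ((1≤a , inj₂ r₂) , a≤M , _) → inj₂ (%-injective-pos 1≤a 1≤d+2 a≤M d+2≤M r₂) })
    (λ { refl → (≤-refl , inj₁ refl) , <⇒≤ 1<M , (λ _ → 1<M) })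
    (λ { refl → (1≤d+2 , inj₂ refl) , d+2≤M , (λ r₁ → ⊥-elim (res₁≢res₂ (d + 2) r₁ refl)) })
    (λ { refl 1≡d+2 → 0≢1+n (suc-injective (trans 1≡d+2 (+-comm d 2))) })
    1

  private
    hookSum₁ hookSum₂ : ℕ → ℕ
    hookSum₁ = hookSumOn res₁?
    hookSum₂ = hookSumOn res₂?

    d+2≢1 : d + 2 ≢ 1
    d+2≢1 d+2≡1 = 0≢1+n (sym (suc-injective (trans (sym (+-comm d 2)) d+2≡1)))

    hookSum-split : ∀ n → hookSum n ≡ hookSum₁ n + hookSum₂ n
    hookSum-split n = trans (Σ<-cong n (λ i _ → by-residue (suc i) (n ∸ suc i))) (Σ<-+ n _ _)
      where
      by-residue : ∀ b t → chains b t ≡ when (res₁? b) (chains b t) + when (res₂? b) (chains b t)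
      by-residue b t with res₁? b | res₂? b
      ... | yes r₁ | yes r₂ = ⊥-elim (res₁≢res₂ b r₁ r₂)
      ... | yes _  | no _   = sym (+-identityʳ _)
      ... | no _   | yes _  = refl
      ... | no ¬r₁ | no ¬r₂ = chains-neither b t ¬r₁ ¬r₂

    last-res₁ : ∀ a → when (res₁? a) (chains a 0) ≡ when (a ≟ 1) 1
    last-res₁ a = trans (cong (when (res₁? a)) (chains₀ a)) (by-cases (a ≟ 1) (a ≟ d + 2))
      where
      by-cases : (p : Dec (a ≡ 1)) (q : Dec (a ≡ d + 2)) → when (res₁? a) (when p 1 + when q 1) ≡ when p 1
      by-cases (yes refl) q          = trans (when-yes (res₁? 1) refl _) (cong (1 +_) (when-no q (d+2≢1 ∘ sym) 1))
      by-cases (no _)     (yes refl) = when-no (res₁? (d + 2)) (λ r₁ → res₁≢res₂ (d + 2) r₁ refl) _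
      by-cases (no _)     (no _)     = when-zero (res₁? a)

    last-res₂ : ∀ a → when (res₂? a) (chains a 0) ≡ when (a ≟ d + 2) 1
    last-res₂ a = trans (cong (when (res₂? a)) (chains₀ a)) (by-cases (a ≟ 1) (a ≟ d + 2))
      where
      by-cases : (p : Dec (a ≡ 1)) (q : Dec (a ≡ d + 2)) → when (res₂? a) (when p 1 + when q 1) ≡ when q 1
      by-cases (yes refl) q          = trans (when-no (res₂? 1) (res₁≢res₂ 1 refl) _) (sym (when-no q (d+2≢1 ∘ sym) 1))
      by-cases (no _)     (yes refl) = when-yes (res₂? (d + 2)) refl _
      by-cases (no _)     (no _)     = when-zero (res₂? a)

    hookSum₁-suc : ∀ n → hookSum₁ (suc n) ≡ hookSum₁ n + hookSum₂ (n ∸ d) + when (suc n ≟ 1) 1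
    hookSum₁-suc n = begin
      hookSum₁ (suc n)
        ≡⟨ hookSumOn-suc res₁? n ⟩
      Σ< n (λ i → when (res₁? (suc i)) (chains (suc i) (suc (n ∸ suc i)))) + when (res₁? (suc n)) (chains (suc n) 0)
        ≡⟨ cong₂ _+_ (Σ<-cong n (λ i _ → trans (when-cong (res₁? (suc i)) (res₁? (suc i)) id id (chains-suc-res₁ (suc i) (n ∸ suc i)))
                                                (when-+ (res₁? (suc i)) (chains (suc i) (n ∸ suc i)) _)))
                     (last-res₁ (suc n)) ⟩
      Σ< n (λ i → F i + G i) + when (suc n ≟ 1) 1
        ≡⟨ cong (_+ when (suc n ≟ 1) 1) (Σ<-+ n F G) ⟩
      hookSum₁ n + Σ< n G + when (suc n ≟ 1) 1
        ≡⟨ cong (λ x → hookSum₁ n + x + when (suc n ≟ 1) 1)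
                (Σ<-chains-shift n d res₁? res₂? (λ j → res₁[+d]⇒res₂ (suc j)) (λ j → res₂⇒res₁[+d] (suc j))) ⟩
      hookSum₁ n + hookSum₂ (n ∸ d) + when (suc n ≟ 1) 1 ∎
      where
      open ≡-Reasoning
      F G : ℕ → ℕ
      F i = when (res₁? (suc i)) (chains (suc i) (n ∸ suc i))
      G i = when (res₁? (suc i)) (chains (suc i ∸ d) (n ∸ suc i))

    hookSum₂-suc : ∀ n → hookSum₂ (suc n) ≡ hookSum₂ n + hookSum₁ (n ∸ suc d) + hookSum₂ (n ∸ M d) + when (suc n ≟ d + 2) 1
    hookSum₂-suc n = begin
      hookSum₂ (suc n)
        ≡⟨ hookSumOn-suc res₂? n ⟩
      Σ< n (λ i → when (res₂? (suc i)) (chains (suc i) (suc (n ∸ suc i)))) + when (res₂? (suc n)) (chains (suc n) 0)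
        ≡⟨ cong₂ _+_ (Σ<-cong n (λ i _ → trans (when-cong (res₂? (suc i)) (res₂? (suc i)) id id (chains-suc-res₂ (suc i) (n ∸ suc i)))
                                                (trans (when-+ (res₂? (suc i)) (chains (suc i) (n ∸ suc i) + chains (suc i ∸ suc d) (n ∸ suc i)) _)
                                                       (cong (_+ H i) (when-+ (res₂? (suc i)) (chains (suc i) (n ∸ suc i)) _)))))
                     (last-res₂ (suc n)) ⟩
      Σ< n (λ i → F i + G i + H i) + when (suc n ≟ d + 2) 1
        ≡⟨ cong (_+ when (suc n ≟ d + 2) 1) (trans (Σ<-+ n (λ i → F i + G i) H) (cong (_+ Σ< n H) (Σ<-+ n F G))) ⟩
      hookSum₂ n + Σ< n G + Σ< n H + when (suc n ≟ d + 2) 1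
        ≡⟨ cong (λ x → x + when (suc n ≟ d + 2) 1) (cong₂ _+_
             (cong (hookSum₂ n +_) (Σ<-chains-shift n (suc d) res₂? res₁? (λ j → res₂[+1+d]⇒res₁ (suc j)) (λ j → res₁⇒res₂[+1+d] (suc j))))
             (Σ<-chains-shift n (M d) res₂? res₂? (λ j → trans (sym (res-period (suc j)))) (λ j → trans (res-period (suc j))))) ⟩
      hookSum₂ n + hookSum₁ (n ∸ suc d) + hookSum₂ (n ∸ M d) + when (suc n ≟ d + 2) 1 ∎
      where
      open ≡-Reasoning
      F G H : ℕ → ℕ
      F i = when (res₂? (suc i)) (chains (suc i) (n ∸ suc i))
      G i = when (res₂? (suc i)) (chains (suc i ∸ suc d) (n ∸ suc i))
      H i = when (res₂? (suc i)) (chains (suc i ∸ M d) (n ∸ suc i))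

    hookSum₁-shifted : ∀ n → hookSum₁ (suc n ∸ d) ≡ hookSum₁ (n ∸ d) + hookSum₂ (suc n ∸ M d) + when (suc (suc n) ≟ d + 2) 1
    hookSum₁-shifted n = by-cases (d ≤? n)
      where
      by-cases : Dec (d ≤ n) → hookSum₁ (suc n ∸ d) ≡ hookSum₁ (n ∸ d) + hookSum₂ (suc n ∸ M d) + when (suc (suc n) ≟ d + 2) 1
      by-cases (yes d≤n) = begin
        hookSum₁ (suc n ∸ d)
          ≡⟨ cong hookSum₁ (+-∸-assoc 1 d≤n) ⟩
        hookSum₁ (suc (n ∸ d))
          ≡⟨ hookSum₁-suc (n ∸ d) ⟩
        hookSum₁ (n ∸ d) + hookSum₂ (n ∸ d ∸ d) + when (suc (n ∸ d) ≟ 1) 1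
          ≡⟨ cong₂ (λ x y → hookSum₁ (n ∸ d) + hookSum₂ x + y) (trans (∸-+-assoc n d d) (cong (λ e → n ∸ (d + e)) (sym (+-identityʳ d))))
                   (when-⇔ (suc (n ∸ d) ≟ 1) (suc (suc n) ≟ d + 2) n∸d≡0⇒ ⇒n∸d≡0 1) ⟩
        hookSum₁ (n ∸ d) + hookSum₂ (suc n ∸ M d) + when (suc (suc n) ≟ d + 2) 1 ∎
        where
        open ≡-Reasoning
        n∸d≡0⇒ : suc (n ∸ d) ≡ 1 → suc (suc n) ≡ d + 2
        n∸d≡0⇒ e = trans (cong (λ z → suc (suc z)) (≤-antisym (m∸n≡0⇒m≤n (suc-injective e)) d≤n)) (+-comm 2 d)
        ⇒n∸d≡0 : suc (suc n) ≡ d + 2 → suc (n ∸ d) ≡ 1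
        ⇒n∸d≡0 e = cong suc (trans (cong (_∸ d) (suc-injective (suc-injective (trans e (+-comm d 2))))) (n∸n≡0 d))
      by-cases (no d≰n) = begin
        hookSum₁ (suc n ∸ d)
          ≡⟨ cong hookSum₁ (m≤n⇒m∸n≡0 (≰⇒> d≰n)) ⟩
        0
          ≡⟨ cong₂ _+_ (cong₂ _+_ (cong hookSum₁ (m≤n⇒m∸n≡0 (<⇒≤ (≰⇒> d≰n))))
                                  (cong hookSum₂ (m≤n⇒m∸n≡0 (≤-trans (≰⇒> d≰n) (<⇒≤ d<M)))))
                       (when-no (suc (suc n) ≟ d + 2) (λ e → d≰n (≤-reflexive (sym (suc-injective (suc-injective (trans e (+-comm d 2))))))) 1) ⟨
        hookSum₁ (n ∸ d) + hookSum₂ (suc n ∸ M d) + when (suc (suc n) ≟ d + 2) 1 ∎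
        where open ≡-Reasoning

  hookSum-recurrence : HookRecurrence d hookSum
  hookSum-recurrence = refl , trans (+-identityʳ _) (trans (chains₀ 1) (cong (1 +_) (when-no (1 ≟ d + 2) (d+2≢1 ∘ sym) 1))) , step
    where
    step : ∀ n → hookSum (suc (suc n)) ≡ hookSum (suc n) + hookSum (suc n ∸ d)
    step n = begin
      hookSum (suc (suc n))
        ≡⟨ hookSum-split (suc (suc n)) ⟩
      hookSum₁ (suc (suc n)) + hookSum₂ (suc (suc n))
        ≡⟨ cong₂ _+_ (hookSum₁-suc (suc n)) (hookSum₂-suc (suc n)) ⟩
      hookSum₁ (suc n) + hookSum₂ (suc n ∸ d) + when (suc (suc n) ≟ 1) 1
        + (hookSum₂ (suc n) + hookSum₁ (n ∸ d) + hookSum₂ (suc n ∸ M d) + E)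
        ≡⟨ cong (λ z → hookSum₁ (suc n) + hookSum₂ (suc n ∸ d) + z + (hookSum₂ (suc n) + hookSum₁ (n ∸ d) + hookSum₂ (suc n ∸ M d) + E))
                (when-no (suc (suc n) ≟ 1) (λ ()) 1) ⟩
      hookSum₁ (suc n) + hookSum₂ (suc n ∸ d) + 0 + (hookSum₂ (suc n) + hookSum₁ (n ∸ d) + hookSum₂ (suc n ∸ M d) + E)
        ≡⟨ rearrange (hookSum₁ (suc n)) (hookSum₂ (suc n ∸ d)) (hookSum₂ (suc n)) (hookSum₁ (n ∸ d)) (hookSum₂ (suc n ∸ M d)) E ⟩
      (hookSum₁ (suc n) + hookSum₂ (suc n)) + (hookSum₁ (n ∸ d) + hookSum₂ (suc n ∸ M d) + E + hookSum₂ (suc n ∸ d))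
        ≡⟨ cong₂ _+_ (sym (hookSum-split (suc n))) (cong (_+ hookSum₂ (suc n ∸ d)) (sym (hookSum₁-shifted n))) ⟩
      hookSum (suc n) + (hookSum₁ (suc n ∸ d) + hookSum₂ (suc n ∸ d))
        ≡⟨ cong (hookSum (suc n) +_) (sym (hookSum-split (suc n ∸ d))) ⟩
      hookSum (suc n) + hookSum (suc n ∸ d) ∎
      where
      open ≡-Reasoning
      E : ℕ
      E = when (suc (suc n) ≟ d + 2) 1
      rearrange : ∀ a₁ b₁ b₂ x y e → a₁ + b₁ + 0 + (b₂ + x + y + e) ≡ (a₁ + b₂) + (x + y + e + b₁)
      rearrange = solve-∀

  private
    chains-at-0 : ∀ {x} t → x ≡ 0 → chains x t ≡ 0
    chains-at-0 t refl = chains-from-0 t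

    ∸M≡∸d∸[1+d] : ∀ x → x ∸ M d ≡ x ∸ d ∸ suc d
    ∸M≡∸d∸[1+d] x = trans (cong (x ∸_) (trans M≡1+d+d (+-comm (suc d) d))) (sym (∸-+-assoc x d (suc d)))

    ∸M≡∸[1+d]∸d : ∀ x → x ∸ M d ≡ x ∸ suc d ∸ d
    ∸M≡∸[1+d]∸d x = trans (cong (x ∸_) M≡1+d+d) (sym (∸-+-assoc x (suc d) d))

    res₁-∸d : ∀ {i} → Res₁ i → i ∸ d ≡ 0 ⊎ Res₂ (i ∸ d)
    res₁-∸d {i} r with d ≤? i
    ... | yes d≤i = inj₂ (res₁[+d]⇒res₂ (i ∸ d) (subst Res₁ (sym (m∸n+n≡m d≤i)) r))
    ... | no  d≰i = inj₁ (m≤n⇒m∸n≡0 (<⇒≤ (≰⇒> d≰i)))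

    res₂-∸[1+d] : ∀ {i} → Res₂ i → i ∸ suc d ≡ 0 ⊎ Res₁ (i ∸ suc d)
    res₂-∸[1+d] {i} r with suc d ≤? i
    ... | yes 1+d≤i = inj₂ (res₂[+1+d]⇒res₁ (i ∸ suc d) (subst Res₂ (sym (m∸n+n≡m 1+d≤i)) r))
    ... | no  1+d≰i = inj₁ (m≤n⇒m∸n≡0 (<⇒≤ (≰⇒> 1+d≰i)))

    chains-∸M-neither : ∀ i t → ¬ Res₁ i → ¬ Res₂ i → chains (i ∸ M d) t ≡ 0
    chains-∸M-neither i t ¬r₁ ¬r₂ with M d ≤? i
    ... | yes M≤i = chains-neither (i ∸ M d) t (λ r → ¬r₁ (same r)) (λ r → ¬r₂ (same r))
      where
      same : ∀ {r} → (i ∸ M d) % M d ≡ r → i % M d ≡ r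
      same = trans (trans (cong (_% M d) (sym (m∸n+n≡m M≤i))) (res-period (i ∸ M d)))
    ... | no  M≰i = chains-at-0 t (m≤n⇒m∸n≡0 (<⇒≤ (≰⇒> M≰i)))

    chains-∸[1+d]-suc : ∀ i t → Res₂ i → chains (i ∸ suc d) (suc t) ≡ chains (i ∸ suc d) t + chains (i ∸ M d) t
    chains-∸[1+d]-suc i t r with res₂-∸[1+d] {i} r
    ... | inj₁ i∸[1+d]≡0 = trans (chains-at-0 (suc t) i∸[1+d]≡0)
        (sym (cong₂ _+_ (chains-at-0 t i∸[1+d]≡0) (chains-at-0 t (trans (∸M≡∸[1+d]∸d i) (trans (cong (_∸ d) i∸[1+d]≡0) (0∸n≡0 d))))))
    ... | inj₂ r₁ = trans (chains-suc-res₁ (i ∸ suc d) t r₁) (cong (λ x → chains (i ∸ suc d) t + chains x t) (sym (∸M≡∸[1+d]∸d i)))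

    chains-∸d-suc : ∀ i t → Res₁ i → chains (i ∸ d) (suc t) ≡ chains (i ∸ d) t + chains (i ∸ M d) (suc t)
    chains-∸d-suc i t r with res₁-∸d {i} r
    ... | inj₁ i∸d≡0 = trans (chains-at-0 (suc t) i∸d≡0)
        (sym (cong₂ _+_ (chains-at-0 t i∸d≡0) (chains-at-0 (suc t) (trans (∸M≡∸d∸[1+d] i) (trans (cong (_∸ suc d) i∸d≡0) (0∸n≡0 (suc d)))))))
    ... | inj₂ r₂ = begin
      chains b (suc t)                                              ≡⟨ chains-suc-res₂ b t r₂ ⟩
      chains b t + chains (b ∸ suc d) t + chains (b ∸ M d) t        ≡⟨ +-assoc (chains b t) _ _ ⟩
      chains b t + (chains (b ∸ suc d) t + chains (b ∸ M d) t)      ≡⟨ cong (chains b t +_) (chains-∸[1+d]-suc b t r₂) ⟨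
      chains b t + chains (b ∸ suc d) (suc t)                       ≡⟨ cong (λ x → chains b t + chains x (suc t)) (∸M≡∸d∸[1+d] i) ⟨
      chains b t + chains (i ∸ M d) (suc t)                         ∎
      where
      open ≡-Reasoning
      b = i ∸ d

  chains-recurrence : ∀ i t → chains i (suc (suc t)) + chains i t ≡ chains i (suc t) + chains i (suc t) + chains (i ∸ M d) (suc t)
  chains-recurrence i t = by-residue (res₁? i) (res₂? i)
    where
    by-residue : Dec (Res₁ i) → Dec (Res₂ i) →
      chains i (suc (suc t)) + chains i t ≡ chains i (suc t) + chains i (suc t) + chains (i ∸ M d) (suc t)
    by-residue (yes r₁) _ = begin
      chains i (suc (suc t)) + chains i t
        ≡⟨ cong (_+ chains i t) (chains-suc-res₁ i (suc t) r₁) ⟩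
      chains i (suc t) + chains (i ∸ d) (suc t) + chains i t
        ≡⟨ cong (λ x → chains i (suc t) + x + chains i t) (chains-∸d-suc i t r₁) ⟩
      chains i (suc t) + (chains (i ∸ d) t + chains (i ∸ M d) (suc t)) + chains i t
        ≡⟨ rearrange (chains i (suc t)) (chains (i ∸ d) t) (chains (i ∸ M d) (suc t)) (chains i t) ⟩
      chains i (suc t) + (chains i t + chains (i ∸ d) t) + chains (i ∸ M d) (suc t)
        ≡⟨ cong (λ x → chains i (suc t) + x + chains (i ∸ M d) (suc t)) (chains-suc-res₁ i t r₁) ⟨
      chains i (suc t) + chains i (suc t) + chains (i ∸ M d) (suc t) ∎
      where
      open ≡-Reasoning
      rearrange : ∀ a b c e → a + (b + c) + e ≡ a + (e + b) + c
      rearrange = solve-∀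
    by-residue (no _) (yes r₂) = begin
      chains i (suc (suc t)) + chains i t
        ≡⟨ cong (_+ chains i t) (chains-suc-res₂ i (suc t) r₂) ⟩
      chains i (suc t) + chains (i ∸ suc d) (suc t) + chains (i ∸ M d) (suc t) + chains i t
        ≡⟨ cong (λ x → chains i (suc t) + x + chains (i ∸ M d) (suc t) + chains i t) (chains-∸[1+d]-suc i t r₂) ⟩
      chains i (suc t) + (chains (i ∸ suc d) t + chains (i ∸ M d) t) + chains (i ∸ M d) (suc t) + chains i t
        ≡⟨ rearrange (chains i (suc t)) (chains (i ∸ suc d) t) (chains (i ∸ M d) t) (chains (i ∸ M d) (suc t)) (chains i t) ⟩
      chains i (suc t) + (chains i t + chains (i ∸ suc d) t + chains (i ∸ M d) t) + chains (i ∸ M d) (suc t)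
        ≡⟨ cong (λ x → chains i (suc t) + x + chains (i ∸ M d) (suc t)) (chains-suc-res₂ i t r₂) ⟨
      chains i (suc t) + chains i (suc t) + chains (i ∸ M d) (suc t) ∎
      where
      open ≡-Reasoning
      rearrange : ∀ a b c e f → a + (b + c) + e + f ≡ a + (f + b + c) + e
      rearrange = solve-∀
    by-residue (no ¬r₁) (no ¬r₂) = begin
      chains i (suc (suc t)) + chains i t                              ≡⟨ cong₂ _+_ (chains-neither i (suc (suc t)) ¬r₁ ¬r₂) (chains-neither i t ¬r₁ ¬r₂) ⟩
      0                                                                ≡⟨ cong₂ _+_ (cong₂ _+_ (chains-neither i (suc t) ¬r₁ ¬r₂) (chains-neither i (suc t) ¬r₁ ¬r₂))
                                                                                    (chains-∸M-neither i (suc t) ¬r₁ ¬r₂) ⟨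
      chains i (suc t) + chains i (suc t) + chains (i ∸ M d) (suc t)   ∎
      where open ≡-Reasoning

  private
    chains₀-res₁ : ∀ i → Res₁ i → chains i 0 ≡ when (i ≟ 1) 1
    chains₀-res₁ i r = trans (sym (when-yes (res₁? i) r _)) (last-res₁ i)

    chains₀-res₂ : ∀ i → Res₂ i → chains i 0 ≡ when (i ≟ d + 2) 1
    chains₀-res₂ i r = trans (sym (when-yes (res₂? i) r _)) (last-res₂ i)

    chains₀-∸[1+d] : ∀ i → Res₂ i → chains (i ∸ suc d) 0 ≡ chains i 0
    chains₀-∸[1+d] i r with res₂-∸[1+d] {i} r
    ... | inj₁ i∸[1+d]≡0 = trans (chains-at-0 0 i∸[1+d]≡0)
        (sym (trans (chains₀-res₂ i r) (when-no (i ≟ d + 2) (λ i≡d+2 → 1+n≰n (subst (_≤ suc d) (trans i≡d+2 (+-comm d 2)) (m∸n≡0⇒m≤n i∸[1+d]≡0))) 1)))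
    ... | inj₂ r₁ = trans (chains₀-res₁ (i ∸ suc d) r₁) (trans (when-⇔ (i ∸ suc d ≟ 1) (i ≟ d + 2) ⇒ ⇐ 1) (sym (chains₀-res₂ i r)))
      where
      ⇒ : i ∸ suc d ≡ 1 → i ≡ d + 2
      ⇒ e = trans (sym (m∸n+n≡m {i} {suc d} (<⇒≤ (m∸n≢0⇒n<m (λ e′ → 0≢1+n (trans (sym e′) e)))))) (trans (cong (_+ suc d) e) (+-comm 2 d))
      ⇐ : i ≡ d + 2 → i ∸ suc d ≡ 1
      ⇐ refl = trans (cong (_∸ suc d) (+-comm d 2)) (m+n∸n≡m 1 (suc d))

    chains₀-∸d : ∀ i → Res₁ i → chains (i ∸ d) 0 ≡ chains (i ∸ M d) 0
    chains₀-∸d i r with res₁-∸d {i} r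
    ... | inj₁ i∸d≡0 = trans (chains-at-0 0 i∸d≡0)
        (sym (chains-at-0 0 (trans (∸M≡∸d∸[1+d] i) (trans (cong (_∸ suc d) i∸d≡0) (0∸n≡0 (suc d))))))
    ... | inj₂ r₂ = trans (sym (chains₀-∸[1+d] (i ∸ d) r₂)) (cong (λ x → chains x 0) (sym (∸M≡∸d∸[1+d] i)))

  chains-recurrence₀ : ∀ i → chains i 1 + when (i ≟ 1) 1 ≡ chains i 0 + chains i 0 + chains (i ∸ M d) 0
  chains-recurrence₀ i = by-residue (res₁? i) (res₂? i)
    where
    open ≡-Reasoning
    by-residue : Dec (Res₁ i) → Dec (Res₂ i) → chains i 1 + when (i ≟ 1) 1 ≡ chains i 0 + chains i 0 + chains (i ∸ M d) 0
    by-residue (yes r₁) _ = begin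
      chains i 1 + when (i ≟ 1) 1                          ≡⟨ cong (_+ when (i ≟ 1) 1) (chains-suc-res₁ i 0 r₁) ⟩
      chains i 0 + chains (i ∸ d) 0 + when (i ≟ 1) 1       ≡⟨ +-assoc (chains i 0) _ _ ⟩
      chains i 0 + (chains (i ∸ d) 0 + when (i ≟ 1) 1)     ≡⟨ cong (chains i 0 +_) (+-comm (chains (i ∸ d) 0) _) ⟩
      chains i 0 + (when (i ≟ 1) 1 + chains (i ∸ d) 0)     ≡⟨ +-assoc (chains i 0) _ _ ⟨
      chains i 0 + when (i ≟ 1) 1 + chains (i ∸ d) 0       ≡⟨ cong₂ (λ x y → chains i 0 + x + y) (sym (chains₀-res₁ i r₁)) (chains₀-∸d i r₁) ⟩
      chains i 0 + chains i 0 + chains (i ∸ M d) 0         ∎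
    by-residue (no ¬r₁) (yes r₂) = begin
      chains i 1 + when (i ≟ 1) 1                                       ≡⟨ cong₂ _+_ (chains-suc-res₂ i 0 r₂) (when-no (i ≟ 1) i≢1 1) ⟩
      chains i 0 + chains (i ∸ suc d) 0 + chains (i ∸ M d) 0 + 0       ≡⟨ +-identityʳ _ ⟩
      chains i 0 + chains (i ∸ suc d) 0 + chains (i ∸ M d) 0           ≡⟨ cong (λ x → chains i 0 + x + chains (i ∸ M d) 0) (chains₀-∸[1+d] i r₂) ⟩
      chains i 0 + chains i 0 + chains (i ∸ M d) 0                     ∎
      where
      i≢1 : i ≢ 1
      i≢1 refl = ¬r₁ refl
    by-residue (no ¬r₁) (no ¬r₂) = begin
      chains i 1 + when (i ≟ 1) 1                     ≡⟨ cong₂ _+_ (chains-neither i 1 ¬r₁ ¬r₂) (when-no (i ≟ 1) i≢1 1) ⟩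
      0                                               ≡⟨ cong₂ _+_ (cong₂ _+_ (chains-neither i 0 ¬r₁ ¬r₂) (chains-neither i 0 ¬r₁ ¬r₂))
                                                                   (chains-∸M-neither i 0 ¬r₁ ¬r₂) ⟨
      chains i 0 + chains i 0 + chains (i ∸ M d) 0    ∎
      where
      i≢1 : i ≢ 1
      i≢1 refl = ¬r₁ refl

module PowerSeries where
  open import Data.Integer using (+_)

  whenℤ : Dec A → ℤ → ℤ
  whenℤ (yes _) x = x
  whenℤ (no _)  _ = + 0

  whenℤ-yes : (a? : Dec A) → A → ∀ x → whenℤ a? x ≡ x
  whenℤ-yes (yes _) _ _ = refl
  whenℤ-yes (no ¬a) a _ = ⊥-elim (¬a a)

  whenℤ-no : (a? : Dec A) → ¬ A → ∀ x → whenℤ a? x ≡ + 0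
  whenℤ-no (yes a) ¬a _ = ⊥-elim (¬a a)
  whenℤ-no (no _)  _  _ = refl

  whenℤ-zero : (a? : Dec A) → whenℤ a? (+ 0) ≡ + 0
  whenℤ-zero (yes _) = refl
  whenℤ-zero (no _)  = refl

  whenℤ-⇔ : (a? : Dec A) (b? : Dec B) → (A → B) → (B → A) → ∀ x → whenℤ a? x ≡ whenℤ b? x
  whenℤ-⇔ (yes _) (yes _) _ _ _ = refl
  whenℤ-⇔ (yes a) (no ¬b) f _ _ = ⊥-elim (¬b (f a))
  whenℤ-⇔ (no ¬a) (yes b) _ g _ = ⊥-elim (¬a (g b))
  whenℤ-⇔ (no _)  (no _)  _ _ _ = refl

  whenℤ-+ : (a? : Dec A) → ∀ x y → whenℤ a? (x ℤ.+ y) ≡ whenℤ a? x ℤ.+ whenℤ a? y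
  whenℤ-+ (yes _) _ _ = refl
  whenℤ-+ (no _)  _ _ = refl

  whenℤ-*ˡ : (a? : Dec A) → ∀ x y → x ℤ.* whenℤ a? y ≡ whenℤ a? (x ℤ.* y)
  whenℤ-*ˡ (yes _) _ _ = refl
  whenℤ-*ˡ (no _)  x _ = ℤ.*-zeroʳ x

  whenℤ-*ʳ : (a? : Dec A) → ∀ x y → whenℤ a? x ℤ.* y ≡ whenℤ a? (x ℤ.* y)
  whenℤ-*ʳ (yes _) _ _ = refl
  whenℤ-*ʳ (no _)  _ y = ℤ.*-zeroˡ y

  +-when : (a? : Dec A) → ∀ v → + when a? v ≡ whenℤ a? (+ v)
  +-when (yes _) _ = refl
  +-when (no _)  _ = refl

  sumTo-cong : ∀ n {f g : ℕ → ℤ} → (∀ x → x ≤ n → f x ≡ g x) → sumTo n f ≡ sumTo n g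
  sumTo-cong zero    f≡g = f≡g 0 z≤n
  sumTo-cong (suc n) f≡g = cong₂ ℤ._+_ (sumTo-cong n (λ x x≤n → f≡g x (m≤n⇒m≤1+n x≤n))) (f≡g (suc n) ≤-refl)

  sumTo-zero : ∀ n {f : ℕ → ℤ} → (∀ x → x ≤ n → f x ≡ + 0) → sumTo n f ≡ + 0
  sumTo-zero zero    f≡0 = f≡0 0 z≤n
  sumTo-zero (suc n) f≡0 = cong₂ ℤ._+_ (sumTo-zero n (λ x x≤n → f≡0 x (m≤n⇒m≤1+n x≤n))) (f≡0 (suc n) ≤-refl)

  sumTo-+ : ∀ n (f g : ℕ → ℤ) → sumTo n (λ x → f x ℤ.+ g x) ≡ sumTo n f ℤ.+ sumTo n g
  sumTo-+ zero    f g = refl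
  sumTo-+ (suc n) f g = trans (cong (ℤ._+ (f (suc n) ℤ.+ g (suc n))) (sumTo-+ n f g))
                              (interchangeℤ (sumTo n f) (sumTo n g) (f (suc n)) (g (suc n)))
    where
    open import Algebra.Properties.CommutativeSemigroup ℤ.+-commutativeSemigroup
      using () renaming (interchange to interchangeℤ)

  sumTo-whenℤ : ∀ n (a? : Dec A) (f : ℕ → ℤ) → sumTo n (λ x → whenℤ a? (f x)) ≡ whenℤ a? (sumTo n f)
  sumTo-whenℤ n (yes _) f = refl
  sumTo-whenℤ n (no _)  f = sumTo-zero n (λ _ _ → refl)

  sumTo-point : ∀ n p (f : ℕ → ℤ) → (∀ x → x ≤ n → x ≢ p → f x ≡ + 0) → sumTo n f ≡ whenℤ (p ≤? n) (f p)
  sumTo-point zero    zero    f _   = refl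
  sumTo-point zero    (suc p) f f≡0 = f≡0 0 z≤n (λ ())
  sumTo-point (suc n) p       f f≡0 with p ≟ suc n
  ... | yes refl = begin
    sumTo n f ℤ.+ f (suc n)   ≡⟨ cong (ℤ._+ f (suc n)) (sumTo-zero n (λ x x≤n → f≡0 x (m≤n⇒m≤1+n x≤n) (λ { refl → 1+n≰n x≤n }))) ⟩
    + 0 ℤ.+ f (suc n)         ≡⟨ ℤ.+-identityˡ _ ⟩
    f (suc n)                 ≡⟨ whenℤ-yes (suc n ≤? suc n) ≤-refl _ ⟨
    whenℤ (suc n ≤? suc n) (f (suc n)) ∎
    where open ≡-Reasoning
  ... | no p≢1+n = begin
    sumTo n f ℤ.+ f (suc n)              ≡⟨ cong₂ ℤ._+_ (sumTo-point n p f (λ x x≤n → f≡0 x (m≤n⇒m≤1+n x≤n))) (f≡0 (suc n) ≤-refl (p≢1+n ∘ sym)) ⟩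
    whenℤ (p ≤? n) (f p) ℤ.+ + 0         ≡⟨ ℤ.+-identityʳ _ ⟩
    whenℤ (p ≤? n) (f p)                 ≡⟨ whenℤ-⇔ (p ≤? n) (p ≤? suc n) m≤n⇒m≤1+n (λ p≤1+n → s≤s⁻¹ (≤∧≢⇒< p≤1+n p≢1+n)) (f p) ⟩
    whenℤ (p ≤? suc n) (f p)             ∎
    where open ≡-Reasoning

  sumTo-point-∸ : ∀ n a (F : ℕ → ℤ) → sumTo n (λ x → whenℤ (n ∸ x ≟ a) (F x)) ≡ whenℤ (a ≤? n) (F (n ∸ a))
  sumTo-point-∸ n a F with a ≤? n
  ... | yes a≤n = trans
    (sumTo-point n (n ∸ a) _ (λ x x≤n x≢ → whenℤ-no (n ∸ x ≟ a) (λ e → x≢ (trans (sym (m∸[m∸n]≡n x≤n)) (cong (n ∸_) e))) _))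
    (trans (whenℤ-yes (n ∸ a ≤? n) (m∸n≤m n a) _) (whenℤ-yes (n ∸ (n ∸ a) ≟ a) (m∸[m∸n]≡n a≤n) _))
  ... | no a≰n = sumTo-zero n (λ x _ → whenℤ-no (n ∸ x ≟ a) (λ e → a≰n (subst (_≤ n) e (m∸n≤m n x))) _)

  mono-coefficient : ∀ s a b c i j k → mono s a b c i j k ≡ whenℤ (i ≟ a) (whenℤ (j ≟ b) (whenℤ (k ≟ c) s))
  mono-coefficient s a b c i j k with i ≟ a | j ≟ b | k ≟ c
  ... | yes _ | yes _ | yes _ = refl
  ... | yes _ | yes _ | no _  = refl
  ... | yes _ | no _  | _     = refl
  ... | no _  | _     | _     = refl

  ⊛-mono : ∀ S s a b c i j k →
    (S ⊛ mono s a b c) i j k ≡ whenℤ (a ≤? i) (whenℤ (b ≤? j) (whenℤ (c ≤? k) (S (i ∸ a) (j ∸ b) (k ∸ c) ℤ.* s)))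
  ⊛-mono S s a b c i j k = begin
    sumTo i (λ x → sumTo j (λ y → sumTo k (λ z → S x y z ℤ.* mono s a b c (i ∸ x) (j ∸ y) (k ∸ z))))
      ≡⟨ sumTo-cong i (λ x _ → sumTo-cong j (λ y _ → sumTo-cong k (λ z _ → pull x y z))) ⟩
    sumTo i (λ x → sumTo j (λ y → sumTo k (λ z → whenℤ (i ∸ x ≟ a) (whenℤ (j ∸ y ≟ b) (whenℤ (k ∸ z ≟ c) (S x y z ℤ.* s))))))
      ≡⟨ sumTo-cong i (λ x _ → sumTo-cong j (λ y _ →
           trans (sumTo-whenℤ k (i ∸ x ≟ a) _) (cong (whenℤ (i ∸ x ≟ a))
           (trans (sumTo-whenℤ k (j ∸ y ≟ b) _) (cong (whenℤ (j ∸ y ≟ b)) (sumTo-point-∸ k c (λ z → S x y z ℤ.* s))))))) ⟩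
    sumTo i (λ x → sumTo j (λ y → whenℤ (i ∸ x ≟ a) (whenℤ (j ∸ y ≟ b) (whenℤ (c ≤? k) (S x y (k ∸ c) ℤ.* s)))))
      ≡⟨ sumTo-cong i (λ x _ → trans (sumTo-whenℤ j (i ∸ x ≟ a) _)
           (cong (whenℤ (i ∸ x ≟ a)) (sumTo-point-∸ j b (λ y → whenℤ (c ≤? k) (S x y (k ∸ c) ℤ.* s))))) ⟩
    sumTo i (λ x → whenℤ (i ∸ x ≟ a) (whenℤ (b ≤? j) (whenℤ (c ≤? k) (S x (j ∸ b) (k ∸ c) ℤ.* s))))
      ≡⟨ sumTo-point-∸ i a (λ x → whenℤ (b ≤? j) (whenℤ (c ≤? k) (S x (j ∸ b) (k ∸ c) ℤ.* s))) ⟩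
    whenℤ (a ≤? i) (whenℤ (b ≤? j) (whenℤ (c ≤? k) (S (i ∸ a) (j ∸ b) (k ∸ c) ℤ.* s))) ∎
    where
    open ≡-Reasoning
    pull : ∀ x y z → S x y z ℤ.* mono s a b c (i ∸ x) (j ∸ y) (k ∸ z)
                     ≡ whenℤ (i ∸ x ≟ a) (whenℤ (j ∸ y ≟ b) (whenℤ (k ∸ z ≟ c) (S x y z ℤ.* s)))
    pull x y z = trans (cong (S x y z ℤ.*_) (mono-coefficient s a b c (i ∸ x) (j ∸ y) (k ∸ z)))
      (trans (whenℤ-*ˡ (i ∸ x ≟ a) (S x y z) _) (cong (whenℤ (i ∸ x ≟ a))
      (trans (whenℤ-*ˡ (j ∸ y ≟ b) (S x y z) _) (cong (whenℤ (j ∸ y ≟ b)) (whenℤ-*ˡ (k ∸ z ≟ c) (S x y z) s)))))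

  ⊛-distribˡ-⊕ : ∀ S T U i j k → (S ⊛ (T ⊕ U)) i j k ≡ (S ⊛ T) i j k ℤ.+ (S ⊛ U) i j k
  ⊛-distribˡ-⊕ S T U i j k =
    trans (sumTo-cong i (λ a _ → trans (sumTo-cong j (λ b _ →
      trans (sumTo-cong k (λ c _ → ℤ.*-distribˡ-+ (S a b c) _ _)) (sumTo-+ k _ _))) (sumTo-+ j _ _))) (sumTo-+ i _ _)

  whenℤ-≡0 : (a? : Dec A) → ∀ {x} → (A → x ≡ + 0) → whenℤ a? x ≡ + 0
  whenℤ-≡0 (yes a) x≡0 = x≡0 a
  whenℤ-≡0 (no _)  _   = refl

  whenℤ-redundant : (a? : Dec A) → ∀ {x} → (¬ A → x ≡ + 0) → whenℤ a? x ≡ x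
  whenℤ-redundant (yes _) _   = refl
  whenℤ-redundant (no ¬a) x≡0 = sym (x≡0 ¬a)

  whenℤ-shift : ∀ {x y} k c v → x + c ≡ y → whenℤ (c ≤? k) (whenℤ (x ≟ k ∸ c) v) ≡ whenℤ (y ≟ k) v
  whenℤ-shift {x} {y} k c v x+c≡y with c ≤? k
  ... | yes c≤k = whenℤ-⇔ (x ≟ k ∸ c) (y ≟ k)
        (λ x≡k∸c → trans (sym x+c≡y) (trans (cong (_+ c) x≡k∸c) (m∸n+n≡m c≤k)))
        (λ y≡k → trans (sym (m+n∸n≡m x c)) (cong (_∸ c) (trans x+c≡y y≡k))) v
  ... | no  c≰k = sym (whenℤ-no (y ≟ k) (λ y≡k → c≰k (subst (c ≤_) (trans (+-comm c x) (trans x+c≡y y≡k)) (m≤m+n c x))) v)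

  -- Series supported on the diagonal  i + j = k + 1,  with coefficient  σ i t  at  x^i y^(t+1) q^(i+t).
  record Diagonal (S : FPS) (σ : ℕ → ℕ → ℤ) : Set where
    field
      vanishes : ∀ i k → S i 0 k ≡ + 0
      profile  : ∀ i t k → S i (suc t) k ≡ whenℤ (i + t ≟ k) (σ i t)
  open Diagonal

  private
    vanishes-* : ∀ {S σ} → Diagonal S σ → ∀ x {j} z s → j ≡ 0 → S x j z ℤ.* s ≡ + 0
    vanishes-* S-diag x z s refl = trans (cong (ℤ._* s) (vanishes S-diag x z)) (ℤ.*-zeroˡ s)

  diagonal-≐ : ∀ {S T σ τ} → Diagonal S σ → Diagonal T τ → (∀ i t → σ i t ≡ τ i t) → S ≐ T
  diagonal-≐ S-diag T-diag σ≡τ i zero    k = trans (vanishes S-diag i k) (sym (vanishes T-diag i k))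
  diagonal-≐ S-diag T-diag σ≡τ i (suc t) k =
    trans (profile S-diag i t k) (trans (cong (whenℤ (i + t ≟ k)) (σ≡τ i t)) (sym (profile T-diag i t k)))

  diagonal-⊕ : ∀ {S T σ τ} → Diagonal S σ → Diagonal T τ → Diagonal (S ⊕ T) (λ i t → σ i t ℤ.+ τ i t)
  vanishes (diagonal-⊕ S-diag T-diag) i k = cong₂ ℤ._+_ (vanishes S-diag i k) (vanishes T-diag i k)
  profile  (diagonal-⊕ S-diag T-diag) i t k =
    trans (cong₂ ℤ._+_ (profile S-diag i t k) (profile T-diag i t k)) (sym (whenℤ-+ (i + t ≟ k) _ _))

  diagonal-mono : ∀ s a b c → a + b ≡ c → Diagonal (mono s a (suc b) c) (λ i t → whenℤ (i ≟ a) (whenℤ (suc t ≟ suc b) s))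
  vanishes (diagonal-mono s a b c _) i k = trans (mono-coefficient s a (suc b) c i 0 k) (whenℤ-zero (i ≟ a))
  profile  (diagonal-mono s a b c a+b≡c) i t k = trans (mono-coefficient s a (suc b) c i (suc t) k) (by-cases (i ≟ a) (suc t ≟ suc b))
    where
    by-cases : (p : Dec (i ≡ a)) (q : Dec (suc t ≡ suc b)) →
      whenℤ p (whenℤ q (whenℤ (k ≟ c) s)) ≡ whenℤ (i + t ≟ k) (whenℤ p (whenℤ q s))
    by-cases (yes refl) (yes refl) = whenℤ-⇔ (k ≟ c) (i + t ≟ k) (λ k≡c → trans a+b≡c (sym k≡c)) (λ i+t≡k → trans (sym i+t≡k) a+b≡c) s
    by-cases (yes _)    (no _)     = sym (whenℤ-zero (i + t ≟ k))
    by-cases (no _)     _          = sym (whenℤ-zero (i + t ≟ k))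

  diagonal-⊛-mono : ∀ {S σ} → Diagonal S σ → ∀ s a b c → a + b ≡ c →
    Diagonal (S ⊛ mono s a b c) (λ i t → whenℤ (a ≤? i) (whenℤ (b ≤? t) (σ (i ∸ a) (t ∸ b) ℤ.* s)))
  vanishes (diagonal-⊛-mono {S} S-diag s a b c _) i k = begin
    (S ⊛ mono s a b c) i 0 k
      ≡⟨ ⊛-mono S s a b c i 0 k ⟩
    whenℤ (a ≤? i) (whenℤ (b ≤? 0) (whenℤ (c ≤? k) (S (i ∸ a) (0 ∸ b) (k ∸ c) ℤ.* s)))
      ≡⟨ whenℤ-≡0 (a ≤? i) (λ _ → whenℤ-≡0 (b ≤? 0) (λ _ → whenℤ-≡0 (c ≤? k) (λ _ →
           vanishes-* S-diag (i ∸ a) (k ∸ c) s (0∸n≡0 b)))) ⟩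
    + 0 ∎
    where open ≡-Reasoning
  profile (diagonal-⊛-mono {S} {σ} S-diag s a b c a+b≡c) i t k =
    trans (⊛-mono S s a b c i (suc t) k) (by-cases (a ≤? i) (b ≤? t))
    where
    open ≡-Reasoning
    by-cases : (p : Dec (a ≤ i)) (q : Dec (b ≤ t)) →
      whenℤ p (whenℤ (b ≤? suc t) (whenℤ (c ≤? k) (S (i ∸ a) (suc t ∸ b) (k ∸ c) ℤ.* s)))
        ≡ whenℤ (i + t ≟ k) (whenℤ p (whenℤ q (σ (i ∸ a) (t ∸ b) ℤ.* s)))
    by-cases (no _)    _ = sym (whenℤ-zero (i + t ≟ k))
    by-cases (yes a≤i) (yes b≤t) = begin
      whenℤ (b ≤? suc t) (whenℤ (c ≤? k) (S (i ∸ a) (suc t ∸ b) (k ∸ c) ℤ.* s))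
        ≡⟨ whenℤ-yes (b ≤? suc t) (m≤n⇒m≤1+n b≤t) _ ⟩
      whenℤ (c ≤? k) (S (i ∸ a) (suc t ∸ b) (k ∸ c) ℤ.* s)
        ≡⟨ cong (λ j → whenℤ (c ≤? k) (S (i ∸ a) j (k ∸ c) ℤ.* s)) (+-∸-assoc 1 b≤t) ⟩
      whenℤ (c ≤? k) (S (i ∸ a) (suc (t ∸ b)) (k ∸ c) ℤ.* s)
        ≡⟨ cong (λ x → whenℤ (c ≤? k) (x ℤ.* s)) (profile S-diag (i ∸ a) (t ∸ b) (k ∸ c)) ⟩
      whenℤ (c ≤? k) (whenℤ (i ∸ a + (t ∸ b) ≟ k ∸ c) (σ (i ∸ a) (t ∸ b)) ℤ.* s)
        ≡⟨ cong (whenℤ (c ≤? k)) (whenℤ-*ʳ (i ∸ a + (t ∸ b) ≟ k ∸ c) _ s) ⟩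
      whenℤ (c ≤? k) (whenℤ (i ∸ a + (t ∸ b) ≟ k ∸ c) (σ (i ∸ a) (t ∸ b) ℤ.* s))
        ≡⟨ whenℤ-shift k c _ on-diagonal ⟩
      whenℤ (i + t ≟ k) (σ (i ∸ a) (t ∸ b) ℤ.* s) ∎
      where
      on-diagonal : i ∸ a + (t ∸ b) + c ≡ i + t
      on-diagonal = begin
        i ∸ a + (t ∸ b) + c        ≡⟨ cong (λ e → i ∸ a + (t ∸ b) + e) (sym a+b≡c) ⟩
        i ∸ a + (t ∸ b) + (a + b)  ≡⟨ interchange (i ∸ a) (t ∸ b) a b ⟩
        i ∸ a + a + (t ∸ b + b)    ≡⟨ cong₂ _+_ (m∸n+n≡m a≤i) (m∸n+n≡m b≤t) ⟩
        i + t                      ∎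
    by-cases (yes a≤i) (no b≰t) = trans
      (whenℤ-≡0 (b ≤? suc t) (λ _ → whenℤ-≡0 (c ≤? k) (λ _ →
        vanishes-* S-diag (i ∸ a) (k ∸ c) s (m≤n⇒m∸n≡0 (≰⇒> b≰t)))))
      (sym (whenℤ-zero (i + t ≟ k)))

  diagonal-⊛-⊕ : ∀ S T U {σ τ} → Diagonal (S ⊛ T) σ → Diagonal (S ⊛ U) τ → Diagonal (S ⊛ (T ⊕ U)) (λ i t → σ i t ℤ.+ τ i t)
  vanishes (diagonal-⊛-⊕ S T U ST UT) i k =
    trans (⊛-distribˡ-⊕ S T U i 0 k) (vanishes (diagonal-⊕ ST UT) i k)
  profile (diagonal-⊛-⊕ S T U ST UT) i t k =
    trans (⊛-distribˡ-⊕ S T U i (suc t) k) (profile (diagonal-⊕ ST UT) i t k)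

module GeneratingFunction (d : ℕ) (d≥1 : 1 ≤ d) where
  open import Data.Integer using (+_)
  open PowerSeries
  open Diagonal
  open Family-g d
  open Family-g-recursions d d≥1

  GenG-diagonal : Diagonal (GenG d) (λ i t → + chains i t)
  vanishes GenG-diagonal i k   = cong +_ (count-shape i 0 k)
  profile  GenG-diagonal i t k = trans (cong +_ (count-shape i (suc t) k)) (+-when (i + t ≟ k) (chains i t))

  -- one summand for each monomial of Den d, respectively of Num d
  denProfile numProfile : ℕ → ℕ → ℤ
  denProfile i t = + chains i t ℤ.* + 1
    ℤ.+ whenℤ (1 ≤? t) (+ chains i (t ∸ 1) ℤ.* - + 2)
    ℤ.+ whenℤ (2 ≤? t) (+ chains i (t ∸ 2) ℤ.* + 1)
    ℤ.+ whenℤ (M d ≤? i) (whenℤ (1 ≤? t) (+ chains (i ∸ M d) (t ∸ 1) ℤ.* - + 1))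
  numProfile i t = whenℤ (i ≟ 1) (whenℤ (suc t ≟ 1) (+ 1))
    ℤ.+ whenℤ (i ≟ 1) (whenℤ (suc t ≟ 2) (- + 1))
    ℤ.+ whenℤ (i ≟ d + 2) (whenℤ (suc t ≟ 1) (+ 1))

  GenG⊛Den-diagonal : Diagonal (GenG d ⊛ Den d) denProfile
  GenG⊛Den-diagonal =
    diagonal-⊛-⊕ (GenG d) (m₀ ⊕ m₁ ⊕ m₂) m₃ (diagonal-⊛-⊕ (GenG d) (m₀ ⊕ m₁) m₂ (diagonal-⊛-⊕ (GenG d) m₀ m₁
      (diagonal-⊛-mono GenG-diagonal (+ 1) 0 0 0 refl)
      (diagonal-⊛-mono GenG-diagonal (- + 2) 0 1 1 refl))
      (diagonal-⊛-mono GenG-diagonal (+ 1) 0 2 2 refl))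
      (diagonal-⊛-mono GenG-diagonal (- + 1) (M d) 1 (suc (M d)) (+-comm (M d) 1))
    where
    m₀ = mono (+ 1) 0 0 0
    m₁ = mono (- + 2) 0 1 1
    m₂ = mono (+ 1) 0 2 2
    m₃ = mono (- + 1) (M d) 1 (suc (M d))

  Num-diagonal : Diagonal (Num d) numProfile
  Num-diagonal =
    diagonal-⊕ (diagonal-⊕ (diagonal-mono (+ 1) 1 0 1 refl) (diagonal-mono (- + 1) 1 1 2 refl))
               (diagonal-mono (+ 1) (d + 2) 0 (d + 2) (+-identityʳ (d + 2)))

  private
    M-guard : ∀ i t → whenℤ (M d ≤? i) (+ chains (i ∸ M d) t ℤ.* - + 1) ≡ + chains (i ∸ M d) t ℤ.* - + 1
    M-guard i t = whenℤ-redundant (M d ≤? i) (λ M≰i →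
      trans (cong (λ x → + chains x t ℤ.* - + 1) (m≤n⇒m∸n≡0 (<⇒≤ (≰⇒> M≰i)))) (cong (λ x → + x ℤ.* - + 1) (chains-from-0 t)))

    +-sum : ∀ a b c e f → a + b ≡ c + e + f → + a ℤ.+ + b ≡ + c ℤ.+ + e ℤ.+ + f
    +-sum a b c e f eq = begin
      + a ℤ.+ + b        ≡⟨ ℤ.pos-+ a b ⟨
      + (a + b)          ≡⟨ cong +_ eq ⟩
      + (c + e + f)      ≡⟨ trans (ℤ.pos-+ (c + e) f) (cong (ℤ._+ + f) (ℤ.pos-+ c e)) ⟩
      + c ℤ.+ + e ℤ.+ + f ∎
      where open ≡-Reasoning

    x-y≡0 : ∀ {x y : ℤ} → x ≡ y → x ℤ.- y ≡ + 0
    x-y≡0 {x} refl = ℤ.+-inverseʳ x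

  den≡num : ∀ i t → denProfile i t ≡ numProfile i t
  den≡num i zero = begin
    + chains i 0 ℤ.* + 1 ℤ.+ + 0 ℤ.+ + 0 ℤ.+ whenℤ (M d ≤? i) (+ 0)
      ≡⟨ cong (λ x → + chains i 0 ℤ.* + 1 ℤ.+ + 0 ℤ.+ + 0 ℤ.+ x) (whenℤ-zero (M d ≤? i)) ⟩
    + chains i 0 ℤ.* + 1 ℤ.+ + 0 ℤ.+ + 0 ℤ.+ + 0
      ≡⟨ simplify (+ chains i 0) ⟩
    + chains i 0
      ≡⟨ cong +_ (chains₀ i) ⟩
    + (when (i ≟ 1) 1 + when (i ≟ d + 2) 1)
      ≡⟨ ℤ.pos-+ (when (i ≟ 1) 1) (when (i ≟ d + 2) 1) ⟩
    + when (i ≟ 1) 1 ℤ.+ + when (i ≟ d + 2) 1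
      ≡⟨ cong₂ ℤ._+_ (+-when (i ≟ 1) 1) (+-when (i ≟ d + 2) 1) ⟩
    whenℤ (i ≟ 1) (+ 1) ℤ.+ whenℤ (i ≟ d + 2) (+ 1)
      ≡⟨ cong (ℤ._+ whenℤ (i ≟ d + 2) (+ 1)) (ℤ.+-identityʳ (whenℤ (i ≟ 1) (+ 1))) ⟨
    whenℤ (i ≟ 1) (+ 1) ℤ.+ + 0 ℤ.+ whenℤ (i ≟ d + 2) (+ 1)
      ≡⟨ cong (λ x → whenℤ (i ≟ 1) (+ 1) ℤ.+ x ℤ.+ whenℤ (i ≟ d + 2) (+ 1)) (whenℤ-zero (i ≟ 1)) ⟨
    numProfile i 0 ∎
    where
    open ≡-Reasoning
    simplify : ∀ x → x ℤ.* + 1 ℤ.+ + 0 ℤ.+ + 0 ℤ.+ + 0 ≡ x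
    simplify = solveℤ-∀
  den≡num i (suc zero) = begin
    a ℤ.* + 1 ℤ.+ b ℤ.* - + 2 ℤ.+ + 0 ℤ.+ whenℤ (M d ≤? i) (c ℤ.* - + 1)
      ≡⟨ cong (λ x → a ℤ.* + 1 ℤ.+ b ℤ.* - + 2 ℤ.+ + 0 ℤ.+ x) (M-guard i 0) ⟩
    a ℤ.* + 1 ℤ.+ b ℤ.* - + 2 ℤ.+ + 0 ℤ.+ c ℤ.* - + 1
      ≡⟨ regroup a b c e ⟩
    (a ℤ.+ e) ℤ.- (b ℤ.+ b ℤ.+ c) ℤ.+ ℤ.- e ℤ.+ + 0
      ≡⟨ cong (λ x → x ℤ.+ ℤ.- e ℤ.+ + 0) (x-y≡0 (+-sum (chains i 1) (when (i ≟ 1) 1) (chains i 0) (chains i 0) (chains (i ∸ M d) 0) (chains-recurrence₀ i))) ⟩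
    + 0 ℤ.+ ℤ.- e ℤ.+ + 0
      ≡⟨ cong₂ (λ x y → x ℤ.+ y ℤ.+ + 0) (sym (whenℤ-zero (i ≟ 1))) (trans (cong ℤ.-_ (+-when (i ≟ 1) 1)) (-whenℤ (i ≟ 1))) ⟩
    whenℤ (i ≟ 1) (+ 0) ℤ.+ whenℤ (i ≟ 1) (- + 1) ℤ.+ + 0
      ≡⟨ cong (λ x → whenℤ (i ≟ 1) (+ 0) ℤ.+ whenℤ (i ≟ 1) (- + 1) ℤ.+ x) (whenℤ-zero (i ≟ d + 2)) ⟨
    numProfile i 1 ∎
    where
    open ≡-Reasoning
    a = + chains i 1
    b = + chains i 0
    c = + chains (i ∸ M d) 0
    e = + when (i ≟ 1) 1
    regroup : ∀ a b c e → a ℤ.* + 1 ℤ.+ b ℤ.* - + 2 ℤ.+ + 0 ℤ.+ c ℤ.* - + 1 ≡ (a ℤ.+ e) ℤ.- (b ℤ.+ b ℤ.+ c) ℤ.+ ℤ.- e ℤ.+ + 0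
    regroup = solveℤ-∀
    -whenℤ : (p? : Dec A) → ℤ.- whenℤ p? (+ 1) ≡ whenℤ p? (- + 1)
    -whenℤ (yes _) = refl
    -whenℤ (no _)  = refl
  den≡num i (suc (suc t)) = begin
    a ℤ.* + 1 ℤ.+ b ℤ.* - + 2 ℤ.+ e ℤ.* + 1 ℤ.+ whenℤ (M d ≤? i) (c ℤ.* - + 1)
      ≡⟨ cong (λ x → a ℤ.* + 1 ℤ.+ b ℤ.* - + 2 ℤ.+ e ℤ.* + 1 ℤ.+ x) (M-guard i (suc t)) ⟩
    a ℤ.* + 1 ℤ.+ b ℤ.* - + 2 ℤ.+ e ℤ.* + 1 ℤ.+ c ℤ.* - + 1
      ≡⟨ regroup a b c e ⟩
    (a ℤ.+ e) ℤ.- (b ℤ.+ b ℤ.+ c)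
      ≡⟨ x-y≡0 (+-sum (chains i (suc (suc t))) (chains i t) (chains i (suc t)) (chains i (suc t)) (chains (i ∸ M d) (suc t)) (chains-recurrence i t)) ⟩
    + 0
      ≡⟨ cong₂ (λ x y → x ℤ.+ x ℤ.+ y) (whenℤ-zero (i ≟ 1)) (whenℤ-zero (i ≟ d + 2)) ⟨
    numProfile i (suc (suc t)) ∎
    where
    open ≡-Reasoning
    a = + chains i (suc (suc t))
    b = + chains i (suc t)
    c = + chains (i ∸ M d) (suc t)
    e = + chains i t
    regroup : ∀ a b c e → a ℤ.* + 1 ℤ.+ b ℤ.* - + 2 ℤ.+ e ℤ.* + 1 ℤ.+ c ℤ.* - + 1 ≡ (a ℤ.+ e) ℤ.- (b ℤ.+ b ℤ.+ c)
    regroup = solveℤ-∀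

  generating-function : GenG d ⊛ Den d ≐ Num d
  generating-function = diagonal-≐ GenG⊛Den-diagonal Num-diagonal den≡num

-- h d 0 = f d 0 = g d 0 = 0 as well.
theorem2p17 : (d : ℕ) → 1 ≤ d →
    (GenG d ⊛ Den d ≐ Num d)
    × ((n : ℕ) → 1 ≤ n → (h d n ≡ f d n) × (f d n ≡ g d n))
theorem2p17 d d≥1 = GeneratingFunction.generating-function d d≥1 , λ n _ → h≡f n , f≡g n
  where
  module H = Family-h d
  module F = Family-f d
  module G = Family-g d

  h≡f : ∀ n → h d n ≡ f d n
  h≡f n = begin
    h d n         ≡⟨ H.count-Γ n ⟩
    H.hookSum n   ≡⟨ hookRecurrence-unique d H.hookSum F.hookSum H.hookSum-recurrence (F.hookSum-recurrence d≥1) n ⟩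
    F.hookSum n   ≡⟨ F.count-Γ n ⟨
    f d n         ∎
    where open ≡-Reasoning

  f≡g : ∀ n → f d n ≡ g d n
  f≡g n = begin
    f d n         ≡⟨ F.count-Γ n ⟩
    F.hookSum n   ≡⟨ hookRecurrence-unique d F.hookSum G.hookSum (F.hookSum-recurrence d≥1) (Family-g-recursions.hookSum-recurrence d d≥1) n ⟩
    G.hookSum n   ≡⟨ G.count-Γ n ⟨
    g d n         ∎
    where open ≡-Reasoning
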